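{- Let $G_1,\ldots,G_n$ be pairwise disjoint connected graphs with chosen vertices $x_i\in V(G_i)$, and let $G$ be the circuit of these graphs with respect to $\{x_i\}_{i=1}^n$. Then $$Mo_e(G)\le \sum_{i=1}^{n}Mo_e(G_i)+\sum_{i=1}^{n}|E(G_i)|\,(|E(G)|-|E(G_i)|)+\begin{cases} n\sum_{i=1}^{t}\bigl||E(G_i)|-|E(G_{t+i})|\bigr| & \text{if } n=2t,\\ (n-1)|E(G)| & \text{if } n=2t-1.\end{cases}$$
   Context: Let $n\ge 3$ and let $C_n$ be the cycle with vertices $c_1,\ldots,c_n$ in cyclic order. The circuit of pairwise disjoint connected graphs $G_1,\ldots,G_n$ with respect to vertices $x_i\in V(G_i)$ is obtained from $C_n$ and the $G_i$ by identifying $x_i$ with $c_i$ for each $i$. For a vertex $w$ and an edge $f=ab$ put $d(w,f)=\min\{d(w,a),d(w,b)\}$; for an edge $e=uv$ of $G$, $m_u(e|G)$ is the number of edges $f$ of $G$ with $d(u,f)<d(v,f)$, and $m_v(e|G)$ analogously. The edge Mostar index is $Mo_e(G)=\sum_{e=uv\in E(G)}|m_u(e|G)-m_v(e|G)|$. -}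

module Defs where

open import Data.Bool using (Bool; true; false; _∧_; _∨_; if_then_else_; T)
open import Data.Bool.Properties using (∧-comm; ∨-comm)
open import Data.Nat using (ℕ; zero; suc; _+_; _*_; _∸_; _<?_; ∣_-_∣) renaming (_≡ᵇ_ to _==ℕ_)
open import Data.Fin using (Fin; toℕ; splitAt) renaming (zero to fz; suc to fs)
open import Data.Fin.Properties using () renaming (_≟_ to _≟F_)
open import Data.List using (List; []; _∷_; map; _++_; filter; length; allFin; upTo)
open import Data.Nat.ListAction using (sum)
open import Data.Bool.ListAction using (any)
open import Data.Product using (Σ; _,_; _×_; proj₁; proj₂; ∃)
open import Data.Sum using (inj₁; inj₂)
open import Relation.Nullary using (yes; no; does)
open import Relation.Nullary.Decidable using (⌊_⌋)
open import Relation.Binary.PropositionalEquality using (_≡_; refl; sym; cong)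

record Graph : Set where
  field
    size  : ℕ
    adj   : Fin size → Fin size → Bool
    adj-sym    : ∀ u v → adj u v ≡ adj v u
    adj-irrefl : ∀ u → adj u u ≡ false
open Graph public

Vtx : Graph → Set
Vtx G = Fin (size G)

Edge : Graph → Set
Edge G = Vtx G × Vtx G

pairs : ∀ {A : Set} → List A → List (A × A)
pairs []       = []
pairs (x ∷ xs) = map (x ,_) xs ++ pairs xs

-- E(G): each edge {a,b} listed once, as (a , b) with a < b
edges : (G : Graph) → List (Edge G)
edges G = filter (λ e → T? (adj G (proj₁ e) (proj₂ e))) (pairs (allFin (size G)))
  where open import Data.Bool using (T?)

numEdges : Graph → ℕ
numEdges G = length (edges G)

reach : (G : Graph) → ℕ → Vtx G → Vtx G → Bool
reach G zero    u v = ⌊ u ≟F v ⌋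
reach G (suc m) u v = reach G m u v ∨ any (λ w → adj G u w ∧ reach G m w v) (allFin (size G))

Connected : Graph → Set
Connected G = ∀ (u v : Vtx G) → ∃ λ m → T (reach G m u v)

-- least m < fuel+start (starting from start) with f m, else fuel+start
search : (ℕ → Bool) → ℕ → ℕ → ℕ
search f zero    s = s
search f (suc k) s = if f s then s else search f k (suc s)

-- distance d(u,v) (the length of a shortest walk; correct for connected G,
-- since a shortest walk has length < size G)
dist : (G : Graph) → Vtx G → Vtx G → ℕ
dist G u v = search (λ m → reach G m u v) (size G) 0

distE : (G : Graph) → Vtx G → Edge G → ℕ
distE G w (a , b) = Data.Nat._⊓_ (dist G w a) (dist G w b)
  where import Data.Nat

mStar : (G : Graph) → Vtx G → Vtx G → ℕ
mStar G u v = length (filter (λ f → distE G u f <? distE G v f) (edges G))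

MoE : Graph → ℕ
MoE G = sum (map (λ e → ∣ mStar G (proj₁ e) (proj₂ e) - mStar G (proj₂ e) (proj₁ e) ∣) (edges G))

totalSize : (n : ℕ) → (Fin n → Graph) → ℕ
totalSize zero    G = 0
totalSize (suc n) G = size (G fz) + totalSize n (λ i → G (fs i))

decode : (n : ℕ) (G : Fin n → Graph) → Fin (totalSize n G) → Σ (Fin n) (λ i → Vtx (G i))
decode zero    G ()
decode (suc n) G p with splitAt (size (G fz)) p
... | inj₁ a = fz , a
... | inj₂ q with decode n (λ i → G (fs i)) q
...   | (i , a) = fs i , a

cycAdj : (n : ℕ) → Fin n → Fin n → Bool
cycAdj n i j = (suc (toℕ i) ==ℕ toℕ j) ∨ (suc (toℕ j) ==ℕ toℕ i)
             ∨ ((toℕ i ==ℕ 0) ∧ (suc (toℕ j) ==ℕ n))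
             ∨ ((toℕ j ==ℕ 0) ∧ (suc (toℕ i) ==ℕ n))

module _ (n : ℕ) (G : Fin n → Graph) (x : (i : Fin n) → Vtx (G i)) where

  cAdjΣ : (i : Fin n) → Vtx (G i) → (j : Fin n) → Vtx (G j) → Bool
  cAdjΣ i a j b with i ≟F j
  ... | yes refl = adj (G i) a b
  ... | no _     = (⌊ a ≟F x i ⌋ ∧ ⌊ b ≟F x j ⌋) ∧ cycAdj n i j

  cycAdj-sym : ∀ i j → cycAdj n i j ≡ cycAdj n j i
  cycAdj-sym i j = helper (suc (toℕ i) ==ℕ toℕ j) (suc (toℕ j) ==ℕ toℕ i)
             ((toℕ i ==ℕ 0) ∧ (suc (toℕ j) ==ℕ n)) ((toℕ j ==ℕ 0) ∧ (suc (toℕ i) ==ℕ n))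
    where
      helper : ∀ a b c d → a ∨ b ∨ c ∨ d ≡ b ∨ a ∨ d ∨ c
      helper true  true  c d = refl
      helper true  false c d = refl
      helper false true  c d = refl
      helper false false c d = ∨-comm c d

  cAdjΣ-sym : ∀ i a j b → cAdjΣ i a j b ≡ cAdjΣ j b i a
  cAdjΣ-sym i a j b with i ≟F j | j ≟F i
  ... | yes refl | yes refl = adj-sym (G i) a b
  ... | yes refl | no ne    = Data.Empty.⊥-elim (ne refl)
    where import Data.Empty
  ... | no ne    | yes refl = Data.Empty.⊥-elim (ne refl)
    where import Data.Empty
  ... | no _     | no _
    rewrite ∧-comm ⌊ a ≟F x i ⌋ ⌊ b ≟F x j ⌋ | cycAdj-sym i j = refl

  cAdjΣ-irrefl : ∀ i a → cAdjΣ i a i a ≡ false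
  cAdjΣ-irrefl i a with i ≟F i
  ... | yes refl = adj-irrefl (G i) a
  ... | no ne    = Data.Empty.⊥-elim (ne refl)
    where import Data.Empty

  circuit : Graph
  circuit = record
    { size = totalSize n G
    ; adj  = λ p q → cAdjΣ (proj₁ (decode n G p)) (proj₂ (decode n G p))
                           (proj₁ (decode n G q)) (proj₂ (decode n G q))
    ; adj-sym = λ p q → cAdjΣ-sym (proj₁ (decode n G p)) (proj₂ (decode n G p)) (proj₁ (decode n G q)) (proj₂ (decode n G q))
    ; adj-irrefl = λ p → cAdjΣ-irrefl (proj₁ (decode n G p)) (proj₂ (decode n G p))
    }

sumFin : (n : ℕ) → (Fin n → ℕ) → ℕ
sumFin n f = sum (map f (allFin n))

-- f at a natural-number index (0 outside range)
atℕ : (n : ℕ) → (Fin n → ℕ) → ℕ → ℕ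
atℕ zero    f i       = 0
atℕ (suc n) f zero    = f fz
atℕ (suc n) f (suc i) = atℕ n (λ j → f (fs j)) i

sumℕ : ℕ → (ℕ → ℕ) → ℕ
sumℕ t f = sum (map f (upTo t))

-- Distances in the circuit G are explicit: within a block they are those of Gᵢ, and between
-- blocks a shortest path leaves through the root xᵢ, runs along Cₙ and enters through the root of
-- the target block. For an edge uv of Gᵢ an edge f of Gᵢ is nearer to u than to v in G exactly when
-- it is so in Gᵢ, while of the |E(G)| − |E(Gᵢ)| edges outside Gᵢ each is nearer to at most one of
-- u, v; this gives Mo_e(Gᵢ) + |E(Gᵢ)|(|E(G)| − |E(Gᵢ)|). For a cycle edge cᵢcᵢ₊₁ a block is nearer
-- to cᵢ or to cᵢ₊₁ as a whole, according to its position on Cₙ. If n = 2t − 1, the block opposite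
-- the edge and the edge itself are equidistant from cᵢ and cᵢ₊₁, so the edge contributes at most
-- |E(G)| − |E(G_{i+t})| − 1, and the n cycle edges together at most (n − 1)|E(G)|. If
-- n = 2t, the cycle edges cancel by the reflection exchanging cᵢ and cᵢ₊₁, and every block lies on
-- the opposite side from its antipode, which leaves Σ_{j<t} ||E(G_j)| − |E(G_{t+j})||. All counts
-- run over ordered pairs of vertices, so the argument bounds 4 Mo_e(G).

module Submission where

open import Data.Bool using (Bool; true; false; _∧_; _∨_; not; T; T?)
open import Data.Bool.Properties using (T-∧; T-∨)
open import Data.Empty using (⊥-elim)
open import Data.Fin using (Fin; toℕ; fromℕ<; _↑ˡ_; _↑ʳ_) renaming (zero to fz; suc to fs)
open import Data.Fin.Properties
  using (nonZeroIndex; toℕ<n; toℕ-injective; toℕ-fromℕ<; splitAt-↑ˡ; splitAt-↑ʳ) renaming (_≟_ to _≟F_)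
open import Data.List using (List; []; _∷_; map; _++_; filter; length; allFin; tabulate; applyUpTo)
open import Data.List.Properties using (map-tabulate; map-applyUpTo; map-++)
open import Data.List.Relation.Unary.Any using (satisfied)
open import Data.List.Relation.Unary.Any.Properties using (any⁺; any⁻)
open import Data.List.Membership.Propositional using (lose)
open import Data.List.Membership.Propositional.Properties using (∈-allFin)
open import Data.Nat
open import Data.Nat.Properties
open import Data.Nat.DivMod
open import Data.Nat.ListAction using () renaming (sum to sumᴸ)
open import Data.Nat.ListAction.Properties using (sum-++)
open import Data.Nat.Tactic.RingSolver using (solve-∀)
open import Data.Product using (_×_; _,_; proj₁; proj₂; ∃)
open import Data.Sum using (_⊎_; inj₁; inj₂; [_,_]′)
open import Data.Unit using (tt)
open import Function using (_∘_; _∘′_; Equivalence)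
open import Relation.Nullary using (Dec; yes; no; does; ¬_; contradiction)
open import Relation.Nullary.Decidable using (⌊_⌋; toWitness; fromWitness)
open import Relation.Unary using (Pred; Decidable)
open import Relation.Binary.PropositionalEquality
open import Algebra.Properties.Semiring.Sum +-*-semiring
  using (sum-syntax; sum-cong-≗; ∑-distrib-+; ∑-comm; *-distribˡ-sum; sum-replicate-zero) renaming (sum to ∑)
open import Defs

open Equivalence using (to; from)

-- Indicators and finite sums

⟦_⟧ : Bool → ℕ
⟦ true ⟧  = 1
⟦ false ⟧ = 0

⟦⟧≤1 : ∀ b → ⟦ b ⟧ ≤ 1
⟦⟧≤1 true  = ≤-refl
⟦⟧≤1 false = z≤n

⟦⟧-mono : ∀ {a b} → (T a → T b) → ⟦ a ⟧ ≤ ⟦ b ⟧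
⟦⟧-mono {false}          _ = z≤n
⟦⟧-mono {true} {true}    _ = ≤-refl
⟦⟧-mono {true} {false} a⇒b = ⊥-elim (a⇒b tt)

⟦⟧-injective-T : ∀ {a b} → ⟦ a ⟧ ≡ ⟦ b ⟧ → T b → T a
⟦⟧-injective-T {true}          _ _ = tt
⟦⟧-injective-T {false} {true} () _

¬T⇒⟦⟧≡0 : ∀ {b} → ¬ T b → ⟦ b ⟧ ≡ 0
¬T⇒⟦⟧≡0 {true}  ¬t = ⊥-elim (¬t tt)
¬T⇒⟦⟧≡0 {false} _  = refl

⟦<ᵇ⟧+⟦>ᵇ⟧≤1 : ∀ a b → ⟦ a <ᵇ b ⟧ + ⟦ b <ᵇ a ⟧ ≤ 1
⟦<ᵇ⟧+⟦>ᵇ⟧≤1 a b = exclusive (a <? b) (b <? a)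
  where
  exclusive : (a<b? : Dec (a < b)) (b<a? : Dec (b < a)) → ⟦ does a<b? ⟧ + ⟦ does b<a? ⟧ ≤ 1
  exclusive (yes a<b) (yes b<a) = ⊥-elim (<-asym a<b b<a)
  exclusive (yes _)   (no _)    = ≤-refl
  exclusive (no _)    (yes _)   = ≤-refl
  exclusive (no _)    (no _)    = z≤n

⟦<ᵇ⟧≡1 : ∀ {a b} → a < b → ⟦ a <ᵇ b ⟧ ≡ 1
⟦<ᵇ⟧≡1 {a} {b} a<b = decided (a <? b)
  where
  decided : (a<b? : Dec (a < b)) → ⟦ does a<b? ⟧ ≡ 1
  decided (yes _)   = refl
  decided (no a≮b)  = contradiction a<b a≮b

⟦<ᵇ⟧≡0 : ∀ {a b} → b ≤ a → ⟦ a <ᵇ b ⟧ ≡ 0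
⟦<ᵇ⟧≡0 {a} {b} b≤a = decided (a <? b)
  where
  decided : (a<b? : Dec (a < b)) → ⟦ does a<b? ⟧ ≡ 0
  decided (yes a<b) = contradiction (≤-trans a<b b≤a) (<-irrefl refl)
  decided (no _)    = refl

⟦<ᵇ⟧+⟦>ᵇ⟧+tie≤1 : ∀ a b c → c ≤ 1 → (c ≡ 1 → a ≡ b) → ⟦ a <ᵇ b ⟧ + ⟦ b <ᵇ a ⟧ + c ≤ 1
⟦<ᵇ⟧+⟦>ᵇ⟧+tie≤1 a b zero          _ _ = subst (_≤ 1) (sym (+-identityʳ _)) (⟦<ᵇ⟧+⟦>ᵇ⟧≤1 a b)
⟦<ᵇ⟧+⟦>ᵇ⟧+tie≤1 a b (suc zero)    _ tie with tie refl
... | refl rewrite ⟦<ᵇ⟧≡0 {a} {a} ≤-refl = ≤-refl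
⟦<ᵇ⟧+⟦>ᵇ⟧+tie≤1 a b (suc (suc c)) (s≤s ()) _

⟦<ᵇ⟧-+ʳ : ∀ a b z → ⟦ a + z <ᵇ b + z ⟧ ≡ ⟦ a <ᵇ b ⟧
⟦<ᵇ⟧-+ʳ a b z = agree (a + z <? b + z) (a <? b)
  where
  agree : (p : Dec (a + z < b + z)) (q : Dec (a < b)) → ⟦ does p ⟧ ≡ ⟦ does q ⟧
  agree (yes _)   (yes _)   = refl
  agree (no _)    (no _)    = refl
  agree (yes p)   (no ¬q)   = ⊥-elim (¬q (+-cancelʳ-< z a b p))
  agree (no ¬p)   (yes q)   = ⊥-elim (¬p (+-monoˡ-< z q))

∣a+b-c+d∣≤∣a-c∣+∣b-d∣ : ∀ a b c d → ∣ a + b - (c + d) ∣ ≤ ∣ a - c ∣ + ∣ b - d ∣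
∣a+b-c+d∣≤∣a-c∣+∣b-d∣ a b c d = ≤-trans (∣-∣-triangle (a + b) (c + b) (c + d))
  (+-mono-≤ (≤-reflexive (trans (cong₂ ∣_-_∣ (+-comm a b) (+-comm c b)) (∣m+n-m+o∣≡∣n-o∣ b a c)))
            (≤-reflexive (∣m+n-m+o∣≡∣n-o∣ c b d)))

∣m-n∣≤m+n : ∀ m n → ∣ m - n ∣ ≤ m + n
∣m-n∣≤m+n m n = ≤-trans (∣m-n∣≤m⊔n m n) (m⊔n≤m+n m n)

∣⟦<ᵇ⟧-split∣ : ∀ {a₀ a₁ b₀ b₁} e f → (a₀ < a₁ × b₁ < b₀) ⊎ (a₁ < a₀ × b₀ < b₁) →
  ∣ ⟦ a₀ <ᵇ a₁ ⟧ * e + ⟦ b₀ <ᵇ b₁ ⟧ * f - (⟦ a₁ <ᵇ a₀ ⟧ * e + ⟦ b₁ <ᵇ b₀ ⟧ * f) ∣ ≡ ∣ e - f ∣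
∣⟦<ᵇ⟧-split∣ e f (inj₁ (a₀<a₁ , b₁<b₀))
  rewrite ⟦<ᵇ⟧≡1 a₀<a₁ | ⟦<ᵇ⟧≡0 (<⇒≤ a₀<a₁) | ⟦<ᵇ⟧≡1 b₁<b₀ | ⟦<ᵇ⟧≡0 (<⇒≤ b₁<b₀)
  = cong₂ ∣_-_∣ (trans (+-identityʳ _) (+-identityʳ e)) (+-identityʳ f)
∣⟦<ᵇ⟧-split∣ e f (inj₂ (a₁<a₀ , b₀<b₁))
  rewrite ⟦<ᵇ⟧≡1 a₁<a₀ | ⟦<ᵇ⟧≡0 (<⇒≤ a₁<a₀) | ⟦<ᵇ⟧≡1 b₀<b₁ | ⟦<ᵇ⟧≡0 (<⇒≤ b₀<b₁)
  = trans (cong₂ ∣_-_∣ (+-identityʳ f) (trans (+-identityʳ _) (+-identityʳ e))) (∣-∣-comm f e)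

sumFin≡∑ : ∀ n (f : Fin n → ℕ) → sumFin n f ≡ ∑[ i < n ] f i
sumFin≡∑ n f = trans (cong sumᴸ (map-tabulate (λ i → i) f)) (go n f)
  where
  go : ∀ n (f : Fin n → ℕ) → sumᴸ (tabulate f) ≡ ∑[ i < n ] f i
  go zero    f = refl
  go (suc n) f = cong (f fz +_) (go n (f ∘ fs))

∑-mono-≤ : ∀ n {f g : Fin n → ℕ} → (∀ i → f i ≤ g i) → ∑[ i < n ] f i ≤ ∑[ i < n ] g i
∑-mono-≤ zero    f≤g = z≤n
∑-mono-≤ (suc n) f≤g = +-mono-≤ (f≤g fz) (∑-mono-≤ n (f≤g ∘ fs))

∑-≤-≡⇒≡ : ∀ n {f g : Fin n → ℕ} → (∀ i → f i ≤ g i) → ∑ f ≡ ∑ g → ∀ i → f i ≡ g i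
∑-≤-≡⇒≡ (suc n) {f} {g} f≤g ∑f≡∑g i with m≤n⇒m<n∨m≡n (f≤g fz)
... | inj₁ f0<g0 = ⊥-elim (<⇒≢ (+-mono-<-≤ f0<g0 (∑-mono-≤ n (f≤g ∘ fs))) ∑f≡∑g)
... | inj₂ f0≡g0 with i
...   | fz   = f0≡g0
...   | fs i = ∑-≤-≡⇒≡ n (f≤g ∘ fs) (+-cancelˡ-≡ (f fz) _ _ (trans ∑f≡∑g (cong (_+ _) (sym f0≡g0)))) i

∑-const : ∀ n c → ∑[ i < n ] c ≡ n * c
∑-const zero    c = refl
∑-const (suc n) c = cong (c +_) (∑-const n c)

∑-↑ : ∀ m k (f : Fin (m + k) → ℕ) → ∑ f ≡ ∑[ a < m ] f (a ↑ˡ k) + ∑[ b < k ] f (m ↑ʳ b)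
∑-↑ zero    k f = refl
∑-↑ (suc m) k f = trans (cong (f fz +_) (∑-↑ m k (f ∘ fs))) (sym (+-assoc (f fz) _ _))

δ : ∀ {n} → Fin n → Fin n → ℕ
δ i j = ⟦ ⌊ i ≟F j ⌋ ⟧

∑-δ : ∀ n (a : Fin n) (g : Fin n → ℕ) → ∑[ i < n ] (δ i a * g i) ≡ g a
∑-δ (suc n) fz     g = begin
  g fz + 0 + ∑[ i < n ] (δ (fs i) fz * g (fs i)) ≡⟨ cong (g fz + 0 +_) (sum-replicate-zero n) ⟩
  g fz + 0 + 0                                   ≡⟨ cong (_+ 0) (+-identityʳ (g fz)) ⟩
  g fz + 0                                       ≡⟨ +-identityʳ (g fz) ⟩
  g fz                                           ∎
  where open ≡-Reasoning
∑-δ (suc n) (fs a) g = trans (sum-cong-≗ δ-suc) (∑-δ n a (g ∘ fs))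
  where
  δ-suc : ∀ i → δ (fs i) (fs a) * g (fs i) ≡ δ i a * g (fs i)
  δ-suc i with i ≟F a
  ... | yes _ = refl
  ... | no _  = refl

∑-δ′ : ∀ n (a : Fin n) (g : Fin n → ℕ) → ∑[ i < n ] (δ a i * g i) ≡ g a
∑-δ′ n a g = trans (sum-cong-≗ (λ i → cong (_* g i) (δ-sym i))) (∑-δ n a g)
  where
  δ-sym : ∀ i → δ a i ≡ δ i a
  δ-sym i with a ≟F i | i ≟F a
  ... | yes _    | yes _  = refl
  ... | no _     | no _   = refl
  ... | yes refl | no a≢a = contradiction refl a≢a
  ... | no a≢a   | yes refl = contradiction refl a≢a

∑-pick : ∀ n (a : Fin n) (f : Fin n → ℕ) → ∑ f ≡ f a + ∑[ i < n ] (⟦ not ⌊ i ≟F a ⌋ ⟧ * f i)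
∑-pick n a f = begin
  ∑ f                                  ≡⟨ sum-cong-≗ {n} split ⟩
  ∑[ i < n ] (δ i a * f i + rest i)    ≡⟨ ∑-distrib-+ {n} _ _ ⟩
  ∑[ i < n ] (δ i a * f i) + ∑ rest    ≡⟨ cong (_+ ∑ rest) (∑-δ n a f) ⟩
  f a + ∑ rest                         ∎
  where
  open ≡-Reasoning
  rest : Fin n → ℕ
  rest i = ⟦ not ⌊ i ≟F a ⌋ ⟧ * f i
  split : ∀ i → f i ≡ δ i a * f i + ⟦ not ⌊ i ≟F a ⌋ ⟧ * f i
  split i with i ≟F a
  ... | yes _ = sym (trans (+-identityʳ _) (+-identityʳ _))
  ... | no _  = sym (+-identityʳ _)

∣∑-∑∣≤∑∣-∣ : ∀ n (f g : Fin n → ℕ) → ∣ ∑ f - ∑ g ∣ ≤ ∑[ i < n ] ∣ f i - g i ∣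
∣∑-∑∣≤∑∣-∣ zero    f g = z≤n
∣∑-∑∣≤∑∣-∣ (suc n) f g =
  ≤-trans (∣a+b-c+d∣≤∣a-c∣+∣b-d∣ (f fz) _ (g fz) _) (+-monoʳ-≤ _ (∣∑-∑∣≤∑∣-∣ n (f ∘ fs) (g ∘ fs)))

atℕ-toℕ : ∀ m (f : Fin m → ℕ) (k : Fin m) → atℕ m f (toℕ k) ≡ f k
atℕ-toℕ (suc m) f fz     = refl
atℕ-toℕ (suc m) f (fs k) = atℕ-toℕ m (f ∘ fs) k

∑ℕ : ℕ → (ℕ → ℕ) → ℕ
∑ℕ m F = ∑[ d < m ] F (toℕ d)

sumℕ≡∑ℕ : ∀ t (F : ℕ → ℕ) → sumℕ t F ≡ ∑ℕ t F
sumℕ≡∑ℕ t F = trans (cong sumᴸ (map-applyUpTo (λ i → i) F t)) (go t F)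
  where
  go : ∀ t (F : ℕ → ℕ) → sumᴸ (applyUpTo F t) ≡ ∑ℕ t F
  go zero    F = refl
  go (suc t) F = cong (F 0 +_) (go t (F ∘ suc))

∑ℕ-cong< : ∀ m {F F′ : ℕ → ℕ} → (∀ d → d < m → F d ≡ F′ d) → ∑ℕ m F ≡ ∑ℕ m F′
∑ℕ-cong< m F≡F′ = sum-cong-≗ (λ d → F≡F′ (toℕ d) (toℕ<n d))

∑ℕ-snoc : ∀ m (F : ℕ → ℕ) → ∑ℕ (suc m) F ≡ ∑ℕ m F + F m
∑ℕ-snoc zero    F = +-comm (F 0) 0
∑ℕ-snoc (suc m) F = trans (cong (F 0 +_) (∑ℕ-snoc m (F ∘ suc))) (sym (+-assoc (F 0) _ _))

∑ℕ-+ : ∀ a b F → ∑ℕ (a + b) F ≡ ∑ℕ a F + ∑ℕ b (λ j → F (a + j))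
∑ℕ-+ zero    b F = refl
∑ℕ-+ (suc a) b F = trans (cong (F 0 +_) (∑ℕ-+ a b (F ∘ suc))) (sym (+-assoc (F 0) _ _))

Periodic : ℕ → (ℕ → ℕ) → Set
Periodic m F = ∀ y → F (y + m) ≡ F y

∑ℕ-rotate-suc : ∀ m (F : ℕ → ℕ) → Periodic m F → ∑ℕ m (F ∘ suc) ≡ ∑ℕ m F
∑ℕ-rotate-suc zero    F per = refl
∑ℕ-rotate-suc (suc m) F per =
  trans (∑ℕ-snoc m (F ∘ suc)) (trans (cong (∑ℕ m (F ∘ suc) +_) (per 0)) (+-comm _ (F 0)))

∑ℕ-rotate : ∀ m (F : ℕ → ℕ) c → Periodic m F → ∑ℕ m (λ d → F (d + c)) ≡ ∑ℕ m F
∑ℕ-rotate m F zero    per = sum-cong-≗ {m} (λ d → cong F (+-identityʳ (toℕ d)))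
∑ℕ-rotate m F (suc c) per = begin
  ∑ℕ m (λ d → F (d + suc c))   ≡⟨ sum-cong-≗ {m} (λ d → cong F (+-suc (toℕ d) c)) ⟩
  ∑ℕ m (λ d → F (suc d + c))   ≡⟨ ∑ℕ-rotate-suc m (λ y → F (y + c)) per-c ⟩
  ∑ℕ m (λ d → F (d + c))       ≡⟨ ∑ℕ-rotate m F c per ⟩
  ∑ℕ m F                       ∎
  where
  open ≡-Reasoning
  per-c : Periodic m (λ y → F (y + c))
  per-c y = trans (cong F (trans (+-assoc y m c) (trans (cong (y +_) (+-comm m c)) (sym (+-assoc y c m)))))
                  (per (y + c))

∑ℕ-reverse : ∀ m (F : ℕ → ℕ) → F m ≡ F 0 → ∑ℕ m (λ d → F (m ∸ d)) ≡ ∑ℕ m F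
∑ℕ-reverse zero    F _   = refl
∑ℕ-reverse (suc m) F Fm≡F0 = cong₂ _+_ Fm≡F0 (shifted m F)
  where
  shifted : ∀ m (F : ℕ → ℕ) → ∑ℕ m (λ d → F (m ∸ d)) ≡ ∑ℕ m (F ∘ suc)
  shifted zero    F = refl
  shifted (suc m) F = trans (cong (F (suc m) +_) (shifted m F))
                            (trans (+-comm (F (suc m)) _) (sym (∑ℕ-snoc m (F ∘ suc))))

δℕ : ℕ → ℕ → ℕ
δℕ d c = ⟦ d ≡ᵇ c ⟧

δℕ≤1 : ∀ d c → δℕ d c ≤ 1
δℕ≤1 d c = ⟦⟧≤1 (d ≡ᵇ c)

δℕ≡1⇒≡ : ∀ d c → δℕ d c ≡ 1 → d ≡ c
δℕ≡1⇒≡ d c δ≡1 with d ≡ᵇ c in d≡ᵇc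
... | true  = ≡ᵇ⇒≡ d c (subst T (sym d≡ᵇc) tt)
... | false = ⊥-elim (0≢1+n δ≡1)

∑ℕ-δ : ∀ m c (F : ℕ → ℕ) → c < m → ∑ℕ m (λ d → δℕ d c * F d) ≡ F c
∑ℕ-δ (suc m) zero    F _ =
  trans (cong (F 0 + 0 +_) (sum-replicate-zero m)) (trans (+-identityʳ _) (+-identityʳ _))
∑ℕ-δ (suc m) (suc c) F (s≤s c<m) = ∑ℕ-δ m c (F ∘ suc) c<m

-- Walks and distances

search-least : ∀ (f : ℕ → Bool) fuel s k → s ≤ k → k < s + fuel → T (f k) →
               (∀ j → s ≤ j → j < k → ¬ T (f j)) → search f fuel s ≡ k
search-least f zero s k s≤k k<s _ _ =
  contradiction (≤-trans k<s (≤-trans (≤-reflexive (+-identityʳ s)) s≤k)) (<-irrefl refl)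
search-least f (suc fuel) s k s≤k k<s+fuel fk below with f s in fs≡ | m≤n⇒m<n∨m≡n s≤k
... | true  | inj₂ s≡k = s≡k
... | true  | inj₁ s<k = ⊥-elim (below s ≤-refl s<k (subst T (sym fs≡) tt))
... | false | inj₂ refl = ⊥-elim (subst T fs≡ fk)
... | false | inj₁ s<k =
  search-least f fuel (suc s) k s<k (≤-trans k<s+fuel (≤-reflexive (+-suc s fuel))) fk
    (λ j s<j → below j (≤-trans (n≤1+n s) s<j))

module Walks (H : Graph) where

  record Reach (m : ℕ) (u v : Vtx H) : Set where
    constructor ⟨_⟩
    field reached : T (reach H m u v)
  open Reach public

  reach-zero⇒≡ : ∀ {u v} → Reach 0 u v → u ≡ v
  reach-zero⇒≡ ⟨ t ⟩ = toWitness t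

  reach-refl : ∀ u → Reach 0 u u
  reach-refl u = ⟨ fromWitness refl ⟩

  reach-suc : ∀ {m u v} → Reach m u v → Reach (suc m) u v
  reach-suc ⟨ t ⟩ = ⟨ from T-∨ (inj₁ t) ⟩

  reach-cons : ∀ {m u w v} → T (adj H u w) → Reach m w v → Reach (suc m) u v
  reach-cons {w = w} uw ⟨ r ⟩ =
    ⟨ from T-∨ (inj₂ (any⁺ _ (lose (∈-allFin w) (from T-∧ (uw , r))))) ⟩

  reach-uncons : ∀ {m u v} → Reach (suc m) u v → Reach m u v ⊎ ∃ λ w → T (adj H u w) × Reach m w v
  reach-uncons {m} {u} {v} ⟨ t ⟩ with to T-∨ t
  ... | inj₁ r = inj₁ ⟨ r ⟩
  ... | inj₂ a with satisfied (any⁻ _ (allFin (size H)) a)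
  ...   | w , uw∧r = let (uw , r) = to T-∧ uw∧r in inj₂ (w , uw , ⟨ r ⟩)

  reach-mono : ∀ {m k u v} → m ≤ k → Reach m u v → Reach k u v
  reach-mono {m} m≤k r with m≤n⇒∃[o]m+o≡n m≤k
  ... | o , refl = pad o r
    where
    pad : ∀ {m} o → Reach m _ _ → Reach (m + o) _ _
    pad {m} zero    r rewrite +-identityʳ m = r
    pad {m} (suc o) r rewrite +-suc m o     = reach-suc (pad o r)

  reach-++ : ∀ a {b u w v} → Reach a u w → Reach b w v → Reach (a + b) u v
  reach-++ zero    r s with reach-zero⇒≡ r
  ... | refl = s
  reach-++ (suc a) r s with reach-uncons r
  ... | inj₁ r′            = reach-suc (reach-++ a r′ s)
  ... | inj₂ (_ , uw , r′) = reach-cons uw (reach-++ a r′ s)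

  reach-snoc : ∀ {m u w v} → Reach m u w → T (adj H w v) → Reach (suc m) u v
  reach-snoc {m} {u} {v = v} r wv =
    subst (λ k → Reach k u v) (+-comm m 1) (reach-++ m r (reach-cons wv (reach-refl v)))

  reach-sym : ∀ {m u v} → Reach m u v → Reach m v u
  reach-sym {zero} r with reach-zero⇒≡ r
  ... | refl = r
  reach-sym {suc m} r with reach-uncons r
  ... | inj₁ r′            = reach-suc (reach-sym r′)
  ... | inj₂ (_ , uw , r′) = reach-snoc (reach-sym r′) (subst T (adj-sym H _ _) uw)

  reach-unsnoc : ∀ {m u v} → Reach (suc m) u v → Reach m u v ⊎ ∃ λ w → Reach m u w × T (adj H w v)
  reach-unsnoc {zero} {u} r with reach-uncons r
  ... | inj₁ r′ = inj₁ r′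
  ... | inj₂ (w , uw , r′) with reach-zero⇒≡ r′
  ...   | refl = inj₂ (u , reach-refl u , uw)
  reach-unsnoc {suc m} r with reach-uncons r
  ... | inj₁ r′ = inj₁ r′
  ... | inj₂ (w , uw , r′) with reach-unsnoc r′
  ...   | inj₁ r″              = inj₁ (reach-cons uw r″)
  ...   | inj₂ (w′ , r″ , w′v) = inj₂ (w′ , reach-cons uw r″ , w′v)

  private
    reachable : ℕ → Vtx H → ℕ
    reachable m u = ∑[ v < size H ] ⟦ reach H m u v ⟧

    Saturated : ℕ → Vtx H → Set
    Saturated m u = ∀ v → Reach (suc m) u v → Reach m u v

    saturated-forever : ∀ {m u} → Saturated m u → ∀ k v → Reach (k + m) u v → Reach m u v
    saturated-forever sat zero    v r = r
    saturated-forever sat (suc k) v r with reach-unsnoc r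
    ... | inj₁ r′            = saturated-forever sat k v r′
    ... | inj₂ (w , r′ , wv) = sat v (reach-snoc (saturated-forever sat k w r′) wv)

    reach-grows : ∀ m u v → ⟦ reach H m u v ⟧ ≤ ⟦ reach H (suc m) u v ⟧
    reach-grows m u v = ⟦⟧-mono (λ t → reached (reach-suc {m} {u} {v} ⟨ t ⟩))

    saturated-or-grows : ∀ m u → Saturated m u ⊎ suc (reachable m u) ≤ reachable (suc m) u
    saturated-or-grows m u with reachable m u ≟ reachable (suc m) u
    ... | yes same =
      inj₁ (λ v r → ⟨ ⟦⟧-injective-T (∑-≤-≡⇒≡ (size H) (reach-grows m u) same v) (reached r) ⟩)
    ... | no differ = inj₂ (≤∧≢⇒< (∑-mono-≤ (size H) (reach-grows m u)) differ)

    reachable-zero : ∀ u → reachable 0 u ≡ 1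
    reachable-zero u = trans (sum-cong-≗ {size H} (λ v → sym (*-identityʳ (δ u v)))) (∑-δ′ (size H) u (λ _ → 1))

    reachable≤size : ∀ m u → reachable m u ≤ size H
    reachable≤size m u = ≤-trans (∑-mono-≤ (size H) (λ v → ⟦⟧≤1 (reach H m u v)))
                                  (≤-reflexive (trans (∑-const (size H) 1) (*-identityʳ _)))

    saturates-within : ∀ K u → (∃ λ m → m < K × Saturated m u) ⊎ suc K ≤ reachable K u
    saturates-within zero    u = inj₂ (≤-reflexive (sym (reachable-zero u)))
    saturates-within (suc K) u with saturates-within K u
    ... | inj₁ (m , m<K , sat) = inj₁ (m , m<n⇒m<1+n m<K , sat)
    ... | inj₂ K<reach with saturated-or-grows K u
    ...   | inj₁ sat  = inj₁ (K , ≤-refl , sat)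
    ...   | inj₂ grow = inj₂ (≤-trans (s≤s K<reach) grow)

  -- The vertices reachable within m steps grow with m and, once they stop growing, stay fixed;
  -- so they are fixed from some m < |V(H)| on.
  reach-shorten : ∀ {m u v} → Reach m u v → Reach (pred (size H)) u v
  reach-shorten {m} {u} {v} r with saturates-within (size H) u
  ... | inj₂ too-many = contradiction (≤-trans too-many (reachable≤size (size H) u)) (<-irrefl refl)
  ... | inj₁ (k , k<size , sat) = reach-mono (<⇒≤pred k<size) (saturated-forever sat m v (reach-mono (m≤m+n m k) r))

  Shortest : Vtx H → Vtx H → ℕ → Set
  Shortest u v k = Reach k u v × (∀ j → Reach j u v → k ≤ j)

  dist-shortest : ∀ {u v k} → Shortest u v k → dist H u v ≡ k
  dist-shortest {u} {v} {k} (r , minimal) =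
    search-least (λ m → reach H m u v) (size H) 0 k z≤n k<size (reached r)
      (λ j _ j<k rj → <-irrefl refl (≤-trans j<k (minimal j ⟨ rj ⟩)))
    where
    k<size : k < size H
    k<size = m≤pred[n]⇒suc[m]≤n {{nonZeroIndex u}} (minimal _ (reach-shorten r))

  shortest-exists : ∀ {m u v} → Reach m u v → ∃ (Shortest u v)
  shortest-exists {m} {u} {v} r with first-within (suc m)
    where
    first-within : ∀ n → (∀ i → i < n → ¬ Reach i u v) ⊎ ∃ λ j → j < n × Reach j u v × (∀ i → i < j → ¬ Reach i u v)
    first-within zero = inj₁ (λ _ ())
    first-within (suc n) with first-within n
    ... | inj₂ (j , j<n , rj , below) = inj₂ (j , m<n⇒m<1+n j<n , rj , below)
    ... | inj₁ none with reach H n u v in rn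
    ...   | true  = inj₂ (n , ≤-refl , ⟨ subst T (sym rn) tt ⟩ , none)
    ...   | false = inj₁ λ i i<1+n ri → case (m≤n⇒m<n∨m≡n (≤-pred i<1+n)) ri
      where
      case : ∀ {i} → i < n ⊎ i ≡ n → ¬ Reach i u v
      case (inj₁ i<n) ri  = none _ i<n ri
      case (inj₂ refl) ri = subst T rn (reached ri)
  ... | inj₁ none = ⊥-elim (none m ≤-refl r)
  ... | inj₂ (j , _ , rj , below) = j , rj , λ i ri → ≮⇒≥ (λ i<j → below i i<j ri)

  dist-realised : ∀ {m u v} → Reach m u v → Shortest u v (dist H u v)
  dist-realised r with shortest-exists r
  ... | k , sk = subst (Shortest _ _) (sym (dist-shortest sk)) sk

  dist-refl : ∀ u → dist H u u ≡ 0
  dist-refl u = dist-shortest (reach-refl u , λ _ _ → z≤n)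

  dist-cons : ∀ {m u w v} → T (adj H u w) → Reach m w v → dist H u v ≤ suc (dist H w v)
  dist-cons uw r with dist-realised r
  ... | (r′ , _) = proj₂ (dist-realised (reach-cons uw r′)) _ (reach-cons uw r′)

-- Edge sums as sums over ordered pairs of vertices

∑ᴸ : ∀ {A : Set} → List A → (A → ℕ) → ℕ
∑ᴸ xs f = sumᴸ (map f xs)

∑ᴸ-distrib-+ : ∀ {A : Set} (xs : List A) f g → ∑ᴸ xs (λ x → f x + g x) ≡ ∑ᴸ xs f + ∑ᴸ xs g
∑ᴸ-distrib-+ []       f g = refl
∑ᴸ-distrib-+ (x ∷ xs) f g rewrite ∑ᴸ-distrib-+ xs f g = interchange (f x) (g x) (∑ᴸ xs f) (∑ᴸ xs g)
  where
  interchange : ∀ a b c d → a + b + (c + d) ≡ a + c + (b + d)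
  interchange = solve-∀

∑ᴸ-cong : ∀ {A : Set} (xs : List A) {f g} → (∀ x → f x ≡ g x) → ∑ᴸ xs f ≡ ∑ᴸ xs g
∑ᴸ-cong []       f≡g = refl
∑ᴸ-cong (x ∷ xs) f≡g = cong₂ _+_ (f≡g x) (∑ᴸ-cong xs f≡g)

∑ᴸ-++ : ∀ {A : Set} (xs ys : List A) f → ∑ᴸ (xs ++ ys) f ≡ ∑ᴸ xs f + ∑ᴸ ys f
∑ᴸ-++ xs ys f = trans (cong sumᴸ (map-++ f xs ys)) (sum-++ (map f xs) (map f ys))

∑ᴸ-map : ∀ {A B : Set} (xs : List A) (h : A → B) f → ∑ᴸ (map h xs) f ≡ ∑ᴸ xs (f ∘ h)
∑ᴸ-map []       h f = refl
∑ᴸ-map (x ∷ xs) h f = cong (f (h x) +_) (∑ᴸ-map xs h f)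

*-distribˡ-∑ᴸ : ∀ {A : Set} (xs : List A) c f → c * ∑ᴸ xs f ≡ ∑ᴸ xs (λ x → c * f x)
*-distribˡ-∑ᴸ []       c f = *-zeroʳ c
*-distribˡ-∑ᴸ (x ∷ xs) c f = trans (*-distribˡ-+ c (f x) (∑ᴸ xs f)) (cong (c * f x +_) (*-distribˡ-∑ᴸ xs c f))

∑ᴸ-filter : ∀ {A : Set} {ℓ} {P : Pred A ℓ} (P? : Decidable P) (xs : List A) f →
            ∑ᴸ (filter P? xs) f ≡ ∑ᴸ xs (λ x → ⟦ does (P? x) ⟧ * f x)
∑ᴸ-filter P? []       f = refl
∑ᴸ-filter P? (x ∷ xs) f with does (P? x)
... | true  = cong₂ _+_ (sym (+-identityʳ (f x))) (∑ᴸ-filter P? xs f)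
... | false = ∑ᴸ-filter P? xs f

length≡∑ᴸ1 : ∀ {A : Set} (xs : List A) → length xs ≡ ∑ᴸ xs (λ _ → 1)
length≡∑ᴸ1 []       = refl
length≡∑ᴸ1 (x ∷ xs) = cong suc (length≡∑ᴸ1 xs)

∑ᴸ-pairs : ∀ {A : Set} (xs : List A) (g : A → A → ℕ) →
  ∑ᴸ xs (λ x → ∑ᴸ xs (g x)) ≡ ∑ᴸ (pairs xs) (λ (a , b) → g a b + g b a) + ∑ᴸ xs (λ x → g x x)
∑ᴸ-pairs []       g = refl
∑ᴸ-pairs (x ∷ ys) g = begin
  (g x x + ∑ᴸ ys (g x)) + ∑ᴸ ys (λ y → g y x + ∑ᴸ ys (g y))
    ≡⟨ cong ((g x x + ∑ᴸ ys (g x)) +_) (∑ᴸ-distrib-+ ys (λ y → g y x) (λ y → ∑ᴸ ys (g y))) ⟩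
  (g x x + ∑ᴸ ys (g x)) + (∑ᴸ ys (λ y → g y x) + ∑ᴸ ys (λ y → ∑ᴸ ys (g y)))
    ≡⟨ cong (λ z → (g x x + ∑ᴸ ys (g x)) + (∑ᴸ ys (λ y → g y x) + z)) (∑ᴸ-pairs ys g) ⟩
  (g x x + ∑ᴸ ys (g x)) + (∑ᴸ ys (λ y → g y x) + (∑ᴸ (pairs ys) g² + ∑ᴸ ys (λ y → g y y)))
    ≡⟨ rearrange (g x x) (∑ᴸ ys (g x)) (∑ᴸ ys (λ y → g y x)) (∑ᴸ (pairs ys) g²) (∑ᴸ ys (λ y → g y y)) ⟩
  (∑ᴸ ys (g x) + ∑ᴸ ys (λ y → g y x) + ∑ᴸ (pairs ys) g²) + (g x x + ∑ᴸ ys (λ y → g y y))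
    ≡⟨ cong (λ z → (z + ∑ᴸ (pairs ys) g²) + D) (sym (∑ᴸ-distrib-+ ys (g x) (λ y → g y x))) ⟩
  (∑ᴸ ys (λ y → g x y + g y x) + ∑ᴸ (pairs ys) g²) + (g x x + ∑ᴸ ys (λ y → g y y))
    ≡⟨ cong (λ z → (z + ∑ᴸ (pairs ys) g²) + D) (sym (∑ᴸ-map ys (x ,_) g²)) ⟩
  (∑ᴸ (map (x ,_) ys) g² + ∑ᴸ (pairs ys) g²) + (g x x + ∑ᴸ ys (λ y → g y y))
    ≡⟨ cong (_+ D) (sym (∑ᴸ-++ (map (x ,_) ys) (pairs ys) g²)) ⟩
  ∑ᴸ (map (x ,_) ys ++ pairs ys) g² + (g x x + ∑ᴸ ys (λ y → g y y)) ∎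
  where
  open ≡-Reasoning
  g² = λ ((a , b) : _ × _) → g a b + g b a
  D = g x x + ∑ᴸ ys (λ y → g y y)
  rearrange : ∀ a b c d e → (a + b) + (c + (d + e)) ≡ (b + c + d) + (a + e)
  rearrange = solve-∀

closer : (H : Graph) → Vtx H → Vtx H → Edge H → ℕ
closer H u v f = ⟦ distE H u f <ᵇ distE H v f ⟧

∑∑ : (H : Graph) → (Vtx H → Vtx H → ℕ) → ℕ
∑∑ H F = ∑[ a < size H ] ∑[ b < size H ] F a b

module EdgeSums (H : Graph) where

  private
    s = size H

  ∑-edges : (h : Vtx H → Vtx H → ℕ) → (∀ a b → h a b ≡ h b a) →
            2 * ∑ᴸ (edges H) (λ (a , b) → h a b) ≡ ∑∑ H (λ a b → ⟦ adj H a b ⟧ * h a b)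
  ∑-edges h h-sym = begin
    2 * ∑ᴸ (edges H) (λ (a , b) → h a b)
      ≡⟨ cong (2 *_) (∑ᴸ-filter (λ (a , b) → T? (adj H a b)) (pairs (allFin s)) _) ⟩
    2 * ∑ᴸ (pairs (allFin s)) (λ (a , b) → g a b)
      ≡⟨ *-distribˡ-∑ᴸ (pairs (allFin s)) 2 _ ⟩
    ∑ᴸ (pairs (allFin s)) (λ (a , b) → 2 * g a b)
      ≡⟨ ∑ᴸ-cong (pairs (allFin s)) (λ (a , b) → twice a b) ⟩
    ∑ᴸ (pairs (allFin s)) (λ (a , b) → g a b + g b a)
      ≡⟨ sym (+-identityʳ _) ⟩
    ∑ᴸ (pairs (allFin s)) (λ (a , b) → g a b + g b a) + 0
      ≡⟨ cong (∑ᴸ (pairs (allFin s)) (λ (a , b) → g a b + g b a) +_) (sym no-loops) ⟩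
    ∑ᴸ (pairs (allFin s)) (λ (a , b) → g a b + g b a) + ∑ᴸ (allFin s) (λ a → g a a)
      ≡⟨ sym (∑ᴸ-pairs (allFin s) g) ⟩
    ∑ᴸ (allFin s) (λ a → ∑ᴸ (allFin s) (g a))
      ≡⟨ ∑ᴸ-cong (allFin s) (λ a → sumFin≡∑ s (g a)) ⟩
    ∑ᴸ (allFin s) (λ a → ∑ (g a))
      ≡⟨ sumFin≡∑ s _ ⟩
    ∑∑ H g ∎
    where
    open ≡-Reasoning
    g : Vtx H → Vtx H → ℕ
    g a b = ⟦ adj H a b ⟧ * h a b
    twice : ∀ a b → 2 * g a b ≡ g a b + g b a
    twice a b rewrite adj-sym H b a | h-sym b a = cong (g a b +_) (+-identityʳ (g a b))
    no-loops : ∑ᴸ (allFin s) (λ a → g a a) ≡ 0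
    no-loops = begin
      ∑ᴸ (allFin s) (λ a → g a a)   ≡⟨ ∑ᴸ-cong (allFin s) (λ a → cong (λ z → ⟦ z ⟧ * h a a) (adj-irrefl H a)) ⟩
      ∑ᴸ (allFin s) (λ _ → 0)       ≡⟨ sumFin≡∑ s (λ _ → 0) ⟩
      ∑[ _ < s ] 0                  ≡⟨ sum-replicate-zero s ⟩
      0                             ∎

  2*numEdges : 2 * numEdges H ≡ ∑∑ H (λ a b → ⟦ adj H a b ⟧)
  2*numEdges = begin
    2 * numEdges H                                     ≡⟨ cong (2 *_) (length≡∑ᴸ1 (edges H)) ⟩
    2 * ∑ᴸ (edges H) (λ _ → 1)                         ≡⟨ ∑-edges (λ _ _ → 1) (λ _ _ → refl) ⟩
    ∑∑ H (λ a b → ⟦ adj H a b ⟧ * 1)                   ≡⟨ sum-cong-≗ {s} (λ a → sum-cong-≗ {s} (λ b → *-identityʳ _)) ⟩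
    ∑∑ H (λ a b → ⟦ adj H a b ⟧)                       ∎
    where open ≡-Reasoning

  twiceM : Vtx H → Vtx H → ℕ
  twiceM u v = ∑∑ H (λ a b → ⟦ adj H a b ⟧ * closer H u v (a , b))

  gap : Vtx H → Vtx H → ℕ
  gap u v = ∣ twiceM u v - twiceM v u ∣

  2*mStar : ∀ u v → 2 * mStar H u v ≡ twiceM u v
  2*mStar u v = begin
    2 * mStar H u v
      ≡⟨ cong (2 *_) (length≡∑ᴸ1 (filter (λ f → distE H u f <? distE H v f) (edges H))) ⟩
    2 * ∑ᴸ (filter (λ f → distE H u f <? distE H v f) (edges H)) (λ _ → 1)
      ≡⟨ cong (2 *_) (∑ᴸ-filter (λ f → distE H u f <? distE H v f) (edges H) (λ _ → 1)) ⟩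
    2 * ∑ᴸ (edges H) (λ f → closer H u v f * 1)
      ≡⟨ cong (2 *_) (∑ᴸ-cong (edges H) (λ f → *-identityʳ _)) ⟩
    2 * ∑ᴸ (edges H) (closer H u v)
      ≡⟨ ∑-edges (λ a b → closer H u v (a , b)) closer-sym ⟩
    twiceM u v ∎
    where
    open ≡-Reasoning
    closer-sym : ∀ a b → closer H u v (a , b) ≡ closer H u v (b , a)
    closer-sym a b rewrite ⊓-comm (dist H u a) (dist H u b) | ⊓-comm (dist H v a) (dist H v b) = refl

  4*MoE : 4 * MoE H ≡ ∑∑ H (λ a b → ⟦ adj H a b ⟧ * gap a b)
  4*MoE = begin
    4 * MoE H
      ≡⟨ *-assoc 2 2 (MoE H) ⟩
    2 * (2 * MoE H)
      ≡⟨ cong (2 *_) (∑-edges (λ a b → ∣ mStar H a b - mStar H b a ∣) (λ a b → ∣-∣-comm (mStar H a b) _)) ⟩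
    2 * ∑∑ H (λ a b → ⟦ adj H a b ⟧ * ∣ mStar H a b - mStar H b a ∣)
      ≡⟨ *-distribˡ-sum {s} 2 _ ⟩
    ∑[ a < s ] (2 * ∑[ b < s ] (⟦ adj H a b ⟧ * ∣ mStar H a b - mStar H b a ∣))
      ≡⟨ sum-cong-≗ {s} (λ a → trans (*-distribˡ-sum {s} 2 _) (sum-cong-≗ {s} (doubled a))) ⟩
    ∑∑ H (λ a b → ⟦ adj H a b ⟧ * gap a b) ∎
    where
    open ≡-Reasoning
    doubled : ∀ a b → 2 * (⟦ adj H a b ⟧ * ∣ mStar H a b - mStar H b a ∣)
                      ≡ ⟦ adj H a b ⟧ * gap a b
    doubled a b = begin
      2 * (⟦ adj H a b ⟧ * ∣ mStar H a b - mStar H b a ∣)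
        ≡⟨ x*[y*z]≡y*[x*z] 2 ⟦ adj H a b ⟧ _ ⟩
      ⟦ adj H a b ⟧ * (2 * ∣ mStar H a b - mStar H b a ∣)
        ≡⟨ cong (⟦ adj H a b ⟧ *_) (*-distribˡ-∣-∣ 2 (mStar H a b) (mStar H b a)) ⟩
      ⟦ adj H a b ⟧ * ∣ 2 * mStar H a b - 2 * mStar H b a ∣
        ≡⟨ cong₂ (λ x y → ⟦ adj H a b ⟧ * ∣ x - y ∣) (2*mStar a b) (2*mStar b a) ⟩
      ⟦ adj H a b ⟧ * ∣ twiceM a b - twiceM b a ∣ ∎
      where
      x*[y*z]≡y*[x*z] : ∀ x y z → x * (y * z) ≡ y * (x * z)
      x*[y*z]≡y*[x*z] = solve-∀

-- The cycle Cₙ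

module Modular (n : ℕ) .{{_ : NonZero n}} where

  infix 4 _≈_
  _≈_ : ℕ → ℕ → Set
  a ≈ b = a % n ≡ b % n

  ≈-sym : ∀ {a b} → a ≈ b → b ≈ a
  ≈-sym = sym

  ≈-trans : ∀ {a b c} → a ≈ b → b ≈ c → a ≈ c
  ≈-trans = trans

  ≡⇒≈ : ∀ {a b} → a ≡ b → a ≈ b
  ≡⇒≈ = cong (_% n)

  %-≈ : ∀ a → a % n ≈ a
  %-≈ a = m%n%n≡m%n a n

  n≈0 : n ≈ 0
  n≈0 = trans (n%n≡0 n) (sym (m*n%n≡0 0 n))

  +n≈ : ∀ a → a + n ≈ a
  +n≈ a = [m+n]%n≡m%n a n

  ≈-+ʳ : ∀ {a b} c → a ≈ b → a + c ≈ b + c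
  ≈-+ʳ {a} {b} c a≈b = begin
    (a + c) % n           ≡⟨ %-distribˡ-+ a c n ⟩
    (a % n + c % n) % n   ≡⟨ cong (λ z → (z + c % n) % n) a≈b ⟩
    (b % n + c % n) % n   ≡⟨ %-distribˡ-+ b c n ⟨
    (b + c) % n           ∎
    where open ≡-Reasoning

  ≈-+ˡ : ∀ {a b} c → a ≈ b → c + a ≈ c + b
  ≈-+ˡ {a} {b} c a≈b = subst₂ _≈_ (+-comm a c) (+-comm b c) (≈-+ʳ c a≈b)

  ≈-cancelʳ : ∀ {a b} c → a + c ≈ b + c → a ≈ b
  ≈-cancelʳ {a} {b} c a+c≈b+c = ≈-trans (≈-sym (undo a)) (≈-trans (≈-+ʳ (n ∸ c % n) a+c≈b+c) (undo b))
    where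
    undo : ∀ x → x + c + (n ∸ c % n) ≈ x
    undo x = begin
      (x + c + (n ∸ c % n)) % n     ≡⟨ ≡⇒≈ (+-assoc x c (n ∸ c % n)) ⟩
      (x + (c + (n ∸ c % n))) % n   ≡⟨ ≈-+ˡ x (≈-+ʳ (n ∸ c % n) (≈-sym (%-≈ c))) ⟩
      (x + (c % n + (n ∸ c % n))) % n ≡⟨ ≡⇒≈ (cong (x +_) (m+[n∸m]≡n (m%n≤n c n))) ⟩
      (x + n) % n                   ≡⟨ +n≈ x ⟩
      x % n                         ∎
      where open ≡-Reasoning

  ≈-cancelˡ : ∀ {a b} c → c + a ≈ c + b → a ≈ b
  ≈-cancelˡ {a} {b} c c+a≈c+b = ≈-cancelʳ c (subst₂ _≈_ (+-comm c a) (+-comm c b) c+a≈c+b)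

  ≈⇒≡ : ∀ {a b} → a < n → b < n → a ≈ b → a ≡ b
  ≈⇒≡ a<n b<n a≈b = trans (sym (m<n⇒m%n≡m a<n)) (trans a≈b (m<n⇒m%n≡m b<n))

  neg : ℕ → ℕ
  neg a = n ∸ a % n

  +-neg : ∀ a → a + neg a ≈ 0
  +-neg a = ≈-trans (≈-+ʳ (neg a) (≈-sym (%-≈ a))) (≈-trans (≡⇒≈ (m+[n∸m]≡n (m%n≤n a n))) n≈0)

  suc-% : ∀ y → (suc (y % n) < n × suc y % n ≡ suc (y % n)) ⊎ (suc (y % n) ≡ n × suc y % n ≡ 0)
  suc-% y with m≤n⇒m<n∨m≡n (m%n<n y n)
  ... | inj₁ lt = inj₁ (lt , trans (≈-+ˡ 1 (≈-sym (%-≈ y))) (m<n⇒m%n≡m lt))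
  ... | inj₂ eq = inj₂ (eq , trans (≈-+ˡ 1 (≈-sym (%-≈ y))) (trans (cong (_% n) eq) (n%n≡0 n)))

  -- cycLen x is the distance from c₀ to cₓ in Cₙ; cyc y reads the offset y modulo n
  cycLen : ℕ → ℕ
  cycLen x = x ⊓ (n ∸ x)

  cyc : ℕ → ℕ
  cyc y = cycLen (y % n)

  cyc-≈ : ∀ {a b} → a ≈ b → cyc a ≡ cyc b
  cyc-≈ = cong cycLen

  cyc-≈0 : ∀ {a} → a ≈ 0 → cyc a ≡ 0
  cyc-≈0 {a} a≈0 = trans (cyc-≈ a≈0) (cong cycLen (m*n%n≡0 0 n))

  cycLen-reflect : ∀ x → x ≤ n → cycLen (n ∸ x) ≡ cycLen x
  cycLen-reflect x x≤n = trans (cong ((n ∸ x) ⊓_) (m∸[m∸n]≡n x≤n)) (⊓-comm (n ∸ x) x)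

  cyc-reflect : ∀ a b → a + b ≈ 0 → cyc a ≡ cyc b
  cyc-reflect a b a+b≈0 with a % n in a%n
  ... | zero = sym (cyc-≈0 (≈-cancelˡ a (≈-trans a+b≈0 (≈-sym a+0≈0))))
    where
    a+0≈0 : a + 0 ≈ 0
    a+0≈0 = ≈-trans (≈-+ʳ 0 (≈-sym (%-≈ a))) (≡⇒≈ (cong (_+ 0) a%n))
  ... | suc r = trans (sym (cycLen-reflect (suc r) (<⇒≤ 1+r<n))) (cong cycLen (sym b%n))
    where
    1+r<n : suc r < n
    1+r<n = subst (_< n) a%n (m%n<n a n)
    a+n-1-r≈0 : a + (n ∸ suc r) ≈ 0
    a+n-1-r≈0 = ≈-trans (≈-+ʳ (n ∸ suc r) (≈-sym (%-≈ a)))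
                  (≈-trans (≡⇒≈ (cong (_+ (n ∸ suc r)) a%n)) (≈-trans (≡⇒≈ (m+[n∸m]≡n (<⇒≤ 1+r<n))) n≈0))
    b%n : b % n ≡ n ∸ suc r
    b%n = trans (≈-cancelˡ a (≈-trans a+b≈0 (≈-sym a+n-1-r≈0)))
                (m<n⇒m%n≡m (∸-monoʳ-< {n} {suc r} {0} (s≤s z≤n) (<⇒≤ 1+r<n)))

  cyc-suc≤ : ∀ y → cyc (suc y) ≤ suc (cyc y)
  cyc-suc≤ y with suc-% y
  ... | inj₂ (_ , e) rewrite e = z≤n
  ... | inj₁ (_ , e) rewrite e =
    ⊓-mono-≤ {suc (y % n)} ≤-refl (≤-trans (∸-monoʳ-≤ n (n≤1+n (y % n))) (n≤1+n _))

  cyc≤suc : ∀ y → cyc y ≤ suc (cyc (suc y))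
  cyc≤suc y with suc-% y
  ... | inj₂ (eq , e) rewrite e =
    ≤-trans (m⊓n≤n (y % n) (n ∸ y % n)) (≤-reflexive (trans (cong (_∸ y % n) (sym eq)) (m+n∸n≡m 1 (y % n))))
  ... | inj₁ (lt , e) rewrite e =
    ⊓-mono-≤ {y % n} (≤-trans (n≤1+n _) (n≤1+n _)) (≤-reflexive (+-∸-assoc 1 {n} {suc (y % n)} (<⇒≤ lt)))

module CycleIndices (n : ℕ) (n≥3 : 3 ≤ n) where

  0<n : 0 < n
  0<n = ≤-trans (s≤s z≤n) n≥3

  1<n : 1 < n
  1<n = ≤-trans (s≤s (s≤s z≤n)) n≥3

  instance
    n≢0 : NonZero n
    n≢0 = >-nonZero 0<n

  open Modular n public

  fromℕ% : ℕ → Fin n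
  fromℕ% y = fromℕ< (m%n<n y n)

  toℕ-fromℕ% : ∀ y → toℕ (fromℕ% y) ≡ y % n
  toℕ-fromℕ% y = toℕ-fromℕ< (m%n<n y n)

  toℕ-fromℕ%-≈ : ∀ y → toℕ (fromℕ% y) ≈ y
  toℕ-fromℕ%-≈ y = trans (cong (_% n) (toℕ-fromℕ% y)) (%-≈ y)

  toℕ-≈-injective : ∀ {j k : Fin n} → toℕ j ≈ toℕ k → j ≡ k
  toℕ-≈-injective {j} {k} j≈k = toℕ-injective (≈⇒≡ (toℕ<n j) (toℕ<n k) j≈k)

  fromℕ%-≈ : ∀ {y z} → y ≈ z → fromℕ% y ≡ fromℕ% z
  fromℕ%-≈ {y} {z} y≈z = toℕ-injective (trans (toℕ-fromℕ% y) (trans y≈z (sym (toℕ-fromℕ% z))))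

  fromℕ%-toℕ : ∀ k → fromℕ% (toℕ k) ≡ k
  fromℕ%-toℕ k = toℕ-≈-injective (toℕ-fromℕ%-≈ (toℕ k))

  atℕ-fromℕ% : ∀ (f : Fin n → ℕ) y → y < n → atℕ n f y ≡ f (fromℕ% y)
  atℕ-fromℕ% f y y<n = trans (cong (atℕ n f) (sym (trans (toℕ-fromℕ% y) (m<n⇒m%n≡m y<n)))) (atℕ-toℕ n f (fromℕ% y))

  ≉suc : ∀ a → ¬ (a ≈ suc a)
  ≉suc a a≈1+a with ≈⇒≡ {0} {1} 0<n 1<n
                     (≈-cancelˡ a (≈-trans (≡⇒≈ (+-identityʳ a)) (≈-trans a≈1+a (≡⇒≈ (+-comm 1 a)))))
  ... | ()

  1+[n∸1]≡n : 1 + (n ∸ 1) ≡ n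
  1+[n∸1]≡n = m+[n∸m]≡n 0<n

  next prev : Fin n → Fin n
  next j = fromℕ% (suc (toℕ j))
  prev j = fromℕ% (toℕ j + (n ∸ 1))

  next-prev : ∀ k → next (prev k) ≡ k
  next-prev k = toℕ-≈-injective (begin
    toℕ (next (prev k)) % n            ≡⟨ toℕ-fromℕ%-≈ (suc (toℕ (prev k))) ⟩
    suc (toℕ (prev k)) % n             ≡⟨ ≈-+ˡ 1 (toℕ-fromℕ%-≈ (toℕ k + (n ∸ 1))) ⟩
    (1 + (toℕ k + (n ∸ 1))) % n        ≡⟨ ≡⇒≈ (trans (rotate (toℕ k) (n ∸ 1)) (cong (toℕ k +_) 1+[n∸1]≡n)) ⟩
    (toℕ k + n) % n                    ≡⟨ +n≈ (toℕ k) ⟩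
    toℕ k % n                          ∎)
    where
    open ≡-Reasoning
    rotate : ∀ a b → 1 + (a + b) ≡ a + (1 + b)
    rotate = solve-∀

  next≢prev : ∀ k → next k ≢ prev k
  next≢prev k eq = ⊥-elim (1≉n∸1 (≈-cancelˡ (toℕ k) (≈-trans (≡⇒≈ (+-comm (toℕ k) 1))
                     (≈-trans (≈-sym (toℕ-fromℕ%-≈ (suc (toℕ k))))
                     (≈-trans (cong (λ z → toℕ z % n) eq) (toℕ-fromℕ%-≈ (toℕ k + (n ∸ 1))))))))
    where
    1≉n∸1 : ¬ (1 ≈ n ∸ 1)
    1≉n∸1 1≈n-1 with ≈⇒≡ {2} {0} n≥3 0<n
                          (≈-trans (≈-+ˡ 1 1≈n-1) (≈-trans (≡⇒≈ 1+[n∸1]≡n) n≈0))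
    ... | ()

  cycAdj⇒≈suc : ∀ j j′ → T (cycAdj n j j′) → toℕ j′ ≈ suc (toℕ j) ⊎ toℕ j ≈ suc (toℕ j′)
  cycAdj⇒≈suc j j′ t with suc (toℕ j) ≡ᵇ toℕ j′ in a | suc (toℕ j′) ≡ᵇ toℕ j in b
  ... | true  | _    = inj₁ (≡⇒≈ (sym (≡ᵇ⇒≡ _ _ (subst T (sym a) _))))
  ... | false | true = inj₂ (≡⇒≈ (sym (≡ᵇ⇒≡ _ _ (subst T (sym b) _))))
  ... | false | false with to (T-∨ {(toℕ j ≡ᵇ 0) ∧ (suc (toℕ j′) ≡ᵇ n)}) t
  ...   | inj₁ c = let (j≡0 , 1+j′≡n) = to T-∧ c in
                   inj₂ (≈-trans (≡⇒≈ (≡ᵇ⇒≡ _ _ j≡0)) (≈-trans (≈-sym n≈0) (≡⇒≈ (sym (≡ᵇ⇒≡ _ _ 1+j′≡n)))))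
  ...   | inj₂ d = let (j′≡0 , 1+j≡n) = to T-∧ d in
                   inj₁ (≈-trans (≡⇒≈ (≡ᵇ⇒≡ _ _ j′≡0)) (≈-trans (≈-sym n≈0) (≡⇒≈ (sym (≡ᵇ⇒≡ _ _ 1+j≡n)))))

  cycAdj-next : ∀ j → T (cycAdj n j (next j))
  cycAdj-next j with m≤n⇒m<n∨m≡n (toℕ<n j)
  ... | inj₁ 1+j<n = from T-∨ (inj₁ (≡⇒≡ᵇ _ _ (sym (trans (toℕ-fromℕ% (suc (toℕ j))) (m<n⇒m%n≡m 1+j<n)))))
  ... | inj₂ 1+j≡n =
    from (T-∨ {suc (toℕ j) ≡ᵇ toℕ (next j)}) (inj₂ (from (T-∨ {suc (toℕ (next j)) ≡ᵇ toℕ j}) (inj₂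
      (from (T-∨ {(toℕ j ≡ᵇ 0) ∧ (suc (toℕ (next j)) ≡ᵇ n)}) (inj₂
        (from T-∧ (≡⇒≡ᵇ _ 0 (trans (toℕ-fromℕ% (suc (toℕ j))) (trans (cong (_% n) 1+j≡n) (n%n≡0 n))) ,
                   ≡⇒≡ᵇ _ _ 1+j≡n)))))))

  cycAdj-irrefl : ∀ i → ¬ T (cycAdj n i i)
  cycAdj-irrefl i t with cycAdj⇒≈suc i i t
  ... | inj₁ i≈1+i = ≉suc (toℕ i) i≈1+i
  ... | inj₂ i≈1+i = ≉suc (toℕ i) i≈1+i

  next≢ : ∀ j → j ≢ next j
  next≢ j j≡next = cycAdj-irrefl j (subst (T ∘′ cycAdj n j) (sym j≡next) (cycAdj-next j))

  cycDist : Fin n → Fin n → ℕ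
  cycDist j k = cyc (toℕ k + (n ∸ toℕ j))

  toℕ+[n∸toℕ] : ∀ (j : Fin n) → toℕ j + (n ∸ toℕ j) ≡ n
  toℕ+[n∸toℕ] j = m+[n∸m]≡n (<⇒≤ (toℕ<n j))

  cycDist-refl : ∀ k → cycDist k k ≡ 0
  cycDist-refl k = cyc-≈0 (≈-trans (≡⇒≈ (toℕ+[n∸toℕ] k)) n≈0)

  private
    j+[k+[n∸j]]≈k : ∀ (j k : Fin n) → toℕ j + (toℕ k + (n ∸ toℕ j)) ≈ toℕ k
    j+[k+[n∸j]]≈k j k = ≈-trans (≡⇒≈ (begin
      toℕ j + (toℕ k + (n ∸ toℕ j)) ≡⟨ swap (toℕ j) (toℕ k) (n ∸ toℕ j) ⟩
      toℕ k + (toℕ j + (n ∸ toℕ j)) ≡⟨ cong (toℕ k +_) (toℕ+[n∸toℕ] j) ⟩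
      toℕ k + n                     ∎)) (+n≈ (toℕ k))
      where
      open ≡-Reasoning
      swap : ∀ a b c → a + (b + c) ≡ b + (a + c)
      swap = solve-∀

    offset-suc : ∀ (j j′ k : Fin n) → toℕ j′ ≈ suc (toℕ j) → toℕ k + (n ∸ toℕ j) ≈ suc (toℕ k + (n ∸ toℕ j′))
    offset-suc j j′ k j′≈1+j = ≈-cancelʳ (toℕ j′) (≈-trans (≈-+ˡ (toℕ k + (n ∸ toℕ j)) j′≈1+j)
      (≈-trans (≡⇒≈ (trans (shuffle₁ (toℕ k) (n ∸ toℕ j) (toℕ j)) (cong (suc (toℕ k) +_) (toℕ+[n∸toℕ] j))))
      (≈-sym (≡⇒≈ (trans (shuffle₂ (toℕ k) (n ∸ toℕ j′) (toℕ j′)) (cong (suc (toℕ k) +_) (toℕ+[n∸toℕ] j′)))))))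
      where
      shuffle₁ : ∀ k a j → k + a + (1 + j) ≡ 1 + k + (j + a)
      shuffle₁ = solve-∀
      shuffle₂ : ∀ k a j → 1 + (k + a) + j ≡ 1 + k + (j + a)
      shuffle₂ = solve-∀

  cycDist-realised : ∀ j k → toℕ k ≈ toℕ j + cycDist j k ⊎ toℕ j ≈ toℕ k + cycDist j k
  cycDist-realised j k with ⊓-sel y (n ∸ y)
    where y = (toℕ k + (n ∸ toℕ j)) % n
  ... | inj₁ eq rewrite eq = inj₁ (≈-sym (≈-trans (≈-+ˡ (toℕ j) (%-≈ _)) (j+[k+[n∸j]]≈k j k)))
  ... | inj₂ eq rewrite eq = inj₂ (≈-cancelʳ y (≈-trans (≈-+ˡ (toℕ j) (%-≈ _))
         (≈-trans (j+[k+[n∸j]]≈k j k) (≈-sym (≈-trans (≡⇒≈ (trans (+-assoc (toℕ k) (n ∸ y) y)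
           (cong (toℕ k +_) (trans (+-comm (n ∸ y) y) (m+[n∸m]≡n (m%n≤n _ n)))))) (+n≈ (toℕ k)))))))
    where y = (toℕ k + (n ∸ toℕ j)) % n

  cycDist-cycAdj : ∀ j j′ k → T (cycAdj n j j′) → cycDist j k ≤ suc (cycDist j′ k)
  cycDist-cycAdj j j′ k t with cycAdj⇒≈suc j j′ t
  ... | inj₁ j′≈1+j = subst (_≤ suc (cycDist j′ k)) (sym (cyc-≈ (offset-suc j j′ k j′≈1+j))) (cyc-suc≤ _)
  ... | inj₂ j≈1+j′ = subst (cycDist j k ≤_) (cong suc (sym (cyc-≈ (offset-suc j′ j k j≈1+j′)))) (cyc≤suc _)

  ∑≡∑ℕ-rotated : ∀ (h : Fin n → ℕ) c → ∑ h ≡ ∑ℕ n (λ d → h (fromℕ% (d + c)))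
  ∑≡∑ℕ-rotated h c = begin
    ∑ h                               ≡⟨ sum-cong-≗ {n} (λ k → cong h (sym (fromℕ%-toℕ k))) ⟩
    ∑ℕ n (λ y → h (fromℕ% y))         ≡⟨ ∑ℕ-rotate n (h ∘′ fromℕ%) c (λ y → cong h (fromℕ%-≈ (+n≈ y))) ⟨
    ∑ℕ n (λ d → h (fromℕ% (d + c)))   ∎
    where open ≡-Reasoning

  ∑-rotate : ∀ (h : Fin n → ℕ) c → ∑[ k < n ] h (fromℕ% (toℕ k + c)) ≡ ∑ h
  ∑-rotate h c = sym (∑≡∑ℕ-rotated h c)

  +neg+ : ∀ a b → a + neg b + b ≈ a
  +neg+ a b = ≈-trans (≡⇒≈ (+-assoc a (neg b) b)) (≈-trans (≈-+ˡ a (≡⇒≈ (+-comm (neg b) b)))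
                (≈-trans (≈-+ˡ a (+-neg b)) (≡⇒≈ (+-identityʳ a))))

  -- cycFrom s y is the distance in Cₙ between the offsets s and y
  cycFrom : ℕ → ℕ → ℕ
  cycFrom s y = cyc (y + neg s)

  cycFrom-self : ∀ s → cycFrom s s ≡ 0
  cycFrom-self s = cyc-≈0 (+-neg s)

  cycFrom-≈ : ∀ s {a b} → a ≈ b → cycFrom s a ≡ cycFrom s b
  cycFrom-≈ s a≈b = cyc-≈ (≈-+ʳ (neg s) a≈b)

  cycFrom-periodic : ∀ s → Periodic n (cycFrom s)
  cycFrom-periodic s y = cycFrom-≈ s (+n≈ y)

  cycFrom-0 : ∀ y → cycFrom 0 y ≡ cyc y
  cycFrom-0 y = cyc-≈ (≈-trans (≈-+ˡ y (+-neg 0)) (≡⇒≈ (+-identityʳ y)))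

  neg-1 : neg 1 ≡ n ∸ 1
  neg-1 = cong (n ∸_) (m<n⇒m%n≡m 1<n)

  cycFrom-1 : ∀ y → cycFrom 1 (suc y) ≡ cyc y
  cycFrom-1 y = begin
    cycFrom 1 (suc y)          ≡⟨ cong (λ z → cyc (suc y + z)) neg-1 ⟩
    cyc (suc y + (n ∸ 1))      ≡⟨ cyc-≈ (≈-trans (≡⇒≈ (trans (sym (+-suc y (n ∸ 1))) (cong (y +_) 1+[n∸1]≡n))) (+n≈ y)) ⟩
    cyc y                      ∎
    where open ≡-Reasoning

  cycFrom-reflect : ∀ y₁ y₂ → y₁ + y₂ ≡ suc n → cycFrom 0 y₁ ≡ cycFrom 1 y₂
  cycFrom-reflect y₁ y₂ y₁+y₂≡1+n = trans (cycFrom-0 y₁) (cyc-reflect y₁ (y₂ + neg 1) (begin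
    (y₁ + (y₂ + neg 1)) % n   ≡⟨ cong (_% n) (sym (+-assoc y₁ y₂ (neg 1))) ⟩
    (y₁ + y₂ + neg 1) % n     ≡⟨ cong (_% n) (cong₂ _+_ y₁+y₂≡1+n neg-1) ⟩
    (suc n + (n ∸ 1)) % n     ≡⟨ cong (_% n) (trans (sym (+-suc n (n ∸ 1))) (cong (n +_) 1+[n∸1]≡n)) ⟩
    (n + n) % n               ≡⟨ +n≈ n ⟩
    n % n                     ≡⟨ n≈0 ⟩
    0 % n                     ∎))
    where open ≡-Reasoning

  module EvenCycle (t : ℕ) (n≡t+t : n ≡ t + t) where

    0<t : 0 < t
    0<t = positive t n≡t+t
      where
      positive : ∀ t → n ≡ t + t → 0 < t
      positive (suc _) _   = s≤s z≤n
      positive zero    n≡0 = contradiction (subst (3 ≤_) n≡0 n≥3) λ ()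

    t<n : t < n
    t<n = subst (t <_) (sym n≡t+t) (m<m+n t 0<t)

    private
      n∸t≡t : n ∸ t ≡ t
      n∸t≡t = trans (cong (_∸ t) n≡t+t) (m+n∸n≡m t t)

      cyc-below : ∀ y → y ≤ t → cyc y ≡ y
      cyc-below y y≤t = trans (cong cycLen (m<n⇒m%n≡m (≤-<-trans y≤t t<n)))
        (m≤n⇒m⊓n≡m (≤-trans y≤t (≤-trans (≤-reflexive (sym n∸t≡t)) (∸-monoʳ-≤ n y≤t))))

      cyc-above : ∀ y → t ≤ y → y < n → cyc y ≡ n ∸ y
      cyc-above y t≤y y<n = trans (cong cycLen (m<n⇒m%n≡m y<n))
        (m≥n⇒m⊓n≡n (≤-trans (∸-monoʳ-≤ n t≤y) (≤-trans (≤-reflexive n∸t≡t) t≤y)))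

      t+j<n : ∀ {j} → j < t → t + j < n
      t+j<n j<t = subst (_ <_) (sym n≡t+t) (+-monoʳ-< _ j<t)

    opposite-sides : ∀ j → j < t →
      (cycFrom 0 j < cycFrom 1 j × cycFrom 1 (t + j) < cycFrom 0 (t + j)) ⊎
      (cycFrom 1 j < cycFrom 0 j × cycFrom 0 (t + j) < cycFrom 1 (t + j))
    opposite-sides zero 0<t = inj₁ (subst₂ _<_ (sym (cycFrom-self 0)) (sym from₁0) (s≤s z≤n) ,
                                    subst₂ _<_ (sym from₁t) (sym from₀t) (n<1+n (pred t)))
      where
      1+[t∸1]≡t : suc (pred t) ≡ t
      1+[t∸1]≡t = suc-pred t {{>-nonZero 0<t}}
      from₁0 : cycFrom 1 0 ≡ 1
      from₁0 = begin
        cycFrom 1 0                 ≡⟨ cycFrom-≈ 1 (≈-trans (≈-sym n≈0) (≡⇒≈ (sym 1+[n∸1]≡n))) ⟩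
        cycFrom 1 (suc (n ∸ 1))     ≡⟨ cycFrom-1 (n ∸ 1) ⟩
        cyc (n ∸ 1)                 ≡⟨ cyc-above (n ∸ 1) (≤-pred (subst (t <_) (sym 1+[n∸1]≡n) t<n)) (∸-monoʳ-< (s≤s z≤n) (<⇒≤ 1<n)) ⟩
        n ∸ (n ∸ 1)                 ≡⟨ m∸[m∸n]≡n (<⇒≤ 1<n) ⟩
        1                           ∎
        where open ≡-Reasoning
      from₁t : cycFrom 1 (t + 0) ≡ pred t
      from₁t = begin
        cycFrom 1 (t + 0)           ≡⟨ cong (cycFrom 1) (trans (+-identityʳ t) (sym 1+[t∸1]≡t)) ⟩
        cycFrom 1 (suc (pred t))    ≡⟨ cycFrom-1 (pred t) ⟩
        cyc (pred t)                ≡⟨ cyc-below (pred t) (≤-trans (n≤1+n _) (≤-reflexive 1+[t∸1]≡t)) ⟩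
        pred t                      ∎
        where open ≡-Reasoning
      from₀t : cycFrom 0 (t + 0) ≡ suc (pred t)
      from₀t = trans (cycFrom-0 (t + 0)) (trans (cong cyc (+-identityʳ t)) (trans (cyc-below t ≤-refl) (sym 1+[t∸1]≡t)))
    opposite-sides (suc j) 1+j<t = inj₂ (subst₂ _<_ (sym from₁) (sym from₀) (n<1+n j) ,
                                         subst₂ _<_ (sym from₀′) (sym from₁′) (∸-monoʳ-< (+-monoʳ-< t (n<1+n j)) (<⇒≤ (t+j<n 1+j<t))))
      where
      from₁ : cycFrom 1 (suc j) ≡ j
      from₁ = trans (cycFrom-1 j) (cyc-below j (<⇒≤ (<-trans (n<1+n j) 1+j<t)))
      from₀ : cycFrom 0 (suc j) ≡ suc j
      from₀ = trans (cycFrom-0 (suc j)) (cyc-below (suc j) (<⇒≤ 1+j<t))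
      from₀′ : cycFrom 0 (t + suc j) ≡ n ∸ (t + suc j)
      from₀′ = trans (cycFrom-0 _) (cyc-above _ (m≤m+n t (suc j)) (t+j<n 1+j<t))
      from₁′ : cycFrom 1 (t + suc j) ≡ n ∸ (t + j)
      from₁′ = trans (cong (cycFrom 1) (+-suc t j)) (trans (cycFrom-1 (t + j))
                 (cyc-above _ (m≤m+n t j) (t+j<n (<-trans (n<1+n j) 1+j<t))))

  module Shifted (i₀ : Fin n) where

    shift : ℕ → Fin n
    shift s = fromℕ% (toℕ i₀ + s)

    cycDist-shift : ∀ s y → cycDist (shift s) (shift y) ≡ cycFrom s y
    cycDist-shift s y = cyc-≈ (≈-cancelʳ (toℕ i₀ + s) (≈-trans lhs (≈-sym rhs)))
      where
      I = toℕ i₀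
      lhs : toℕ (shift y) + (n ∸ toℕ (shift s)) + (I + s) ≈ I + y
      lhs = ≈-trans (≡⇒≈ (cong (λ z → toℕ (shift y) + (n ∸ z) + (I + s)) (toℕ-fromℕ% (I + s))))
              (≈-trans (≈-+ʳ (I + s) (≈-+ʳ (neg (I + s)) (toℕ-fromℕ%-≈ (I + y)))) (+neg+ (I + y) (I + s)))
      shuffle : ∀ y g i s → y + g + (i + s) ≡ i + (y + g + s)
      shuffle = solve-∀
      rhs : y + neg s + (I + s) ≈ I + y
      rhs = ≈-trans (≡⇒≈ (shuffle y (neg s) I s)) (≈-+ˡ I (+neg+ y s))

    next-shift : ∀ d → next (shift d) ≡ shift (d + 1)
    next-shift d = fromℕ%-≈ (≈-trans (≈-+ˡ 1 (toℕ-fromℕ%-≈ (toℕ i₀ + d))) (≡⇒≈ (shuffle (toℕ i₀) d)))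
      where
      shuffle : ∀ i d → 1 + (i + d) ≡ i + (d + 1)
      shuffle = solve-∀

    prev-shift : ∀ d → prev (shift d) ≡ shift (d + (n ∸ 1))
    prev-shift d = fromℕ%-≈ (≈-trans (≈-+ʳ (n ∸ 1) (toℕ-fromℕ%-≈ (toℕ i₀ + d))) (≡⇒≈ (+-assoc (toℕ i₀) d (n ∸ 1))))

    ∑≡∑ℕ-shift : ∀ (h : Fin n → ℕ) → ∑ h ≡ ∑ℕ n (h ∘′ shift)
    ∑≡∑ℕ-shift h = trans (∑≡∑ℕ-rotated h (toℕ i₀)) (sum-cong-≗ {n} (λ d → cong (h ∘′ fromℕ%) (+-comm (toℕ d) (toℕ i₀))))

-- Distances in the circuit

ι : ∀ n (G : Fin n → Graph) (i : Fin n) → Vtx (G i) → Fin (totalSize n G)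
ι (suc n) G fz     a = a ↑ˡ totalSize n (G ∘ fs)
ι (suc n) G (fs i) a = size (G fz) ↑ʳ ι n (G ∘ fs) i a

decode-ι : ∀ n G i a → decode n G (ι n G i a) ≡ (i , a)
decode-ι (suc n) G fz     a rewrite splitAt-↑ˡ (size (G fz)) a (totalSize n (G ∘ fs)) = refl
decode-ι (suc n) G (fs i) a rewrite splitAt-↑ʳ (size (G fz)) (totalSize n (G ∘ fs)) (ι n (G ∘ fs) i a)
                                  | decode-ι n (G ∘ fs) i a = refl

∑-blocks : ∀ n G (f : Fin (totalSize n G) → ℕ) → ∑ f ≡ ∑[ i < n ] ∑[ a < size (G i) ] f (ι n G i a)
∑-blocks zero    G f = refl
∑-blocks (suc n) G f = trans (∑-↑ (size (G fz)) _ f)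
  (cong (∑[ a < size (G fz) ] f (ι (suc n) G fz a) +_) (∑-blocks n (G ∘ fs) (λ q → f (size (G fz) ↑ʳ q))))

module Circuit (n : ℕ) (n≥3 : 3 ≤ n) (G : Fin n → Graph) (x : (i : Fin n) → Vtx (G i))
               (connected : ∀ i → Connected (G i)) where

  open CycleIndices n n≥3 public

  C : Graph
  C = circuit n G x

  ιC : (i : Fin n) → Vtx (G i) → Vtx C
  ιC = ι n G

  adjC-ι : ∀ i a j b → adj C (ιC i a) (ιC j b) ≡ cAdjΣ n G x i a j b
  adjC-ι i a j b rewrite decode-ι n G i a | decode-ι n G j b = refl

  cAdjΣ-same : ∀ i a b → cAdjΣ n G x i a i b ≡ adj (G i) a b
  cAdjΣ-same i a b with i ≟F i
  ... | yes refl = refl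
  ... | no i≢i   = ⊥-elim (i≢i refl)

  cAdjΣ-diff : ∀ i a j b → i ≢ j → cAdjΣ n G x i a j b ≡ (⌊ a ≟F x i ⌋ ∧ ⌊ b ≟F x j ⌋) ∧ cycAdj n i j
  cAdjΣ-diff i a j b i≢j with i ≟F j
  ... | yes i≡j = ⊥-elim (i≢j i≡j)
  ... | no _    = refl

  cycAdj-prev : ∀ j → T (cycAdj n j (prev j))
  cycAdj-prev j = subst T (cycAdj-sym n G x (prev j) j) (subst (T ∘′ cycAdj n (prev j)) (next-prev j) (cycAdj-next (prev j)))

  cycAdj⇒next⊎prev : ∀ i j → T (cycAdj n i j) → j ≡ next i ⊎ j ≡ prev i
  cycAdj⇒next⊎prev i j t with cycAdj⇒≈suc i j t
  ... | inj₁ j≈1+i = inj₁ (toℕ-≈-injective (≈-trans j≈1+i (≈-sym (toℕ-fromℕ%-≈ (suc (toℕ i))))))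
  ... | inj₂ i≈1+j = inj₂ (toℕ-≈-injective (≈-trans (≈-cancelʳ 1 j+1≈prev+1) (≈-sym (toℕ-fromℕ%-≈ _))))
    where
    j+1≈prev+1 : toℕ j + 1 ≈ toℕ i + (n ∸ 1) + 1
    j+1≈prev+1 = ≈-trans (≡⇒≈ (+-comm (toℕ j) 1)) (≈-trans (≈-sym i≈1+j) (≈-sym (≈-trans
      (≡⇒≈ (trans (+-assoc (toℕ i) (n ∸ 1) 1) (cong (toℕ i +_) (trans (+-comm (n ∸ 1) 1) 1+[n∸1]≡n)))) (+n≈ (toℕ i)))))

  ⟦cycAdj⟧ : ∀ i j → ⟦ cycAdj n i j ⟧ ≡ δ j (next i) + δ j (prev i)
  ⟦cycAdj⟧ i j with cycAdj n i j in adj? | j ≟F next i | j ≟F prev i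
  ... | _     | yes refl | yes j≡prev = ⊥-elim (next≢prev i j≡prev)
  ... | true  | yes refl | no _       = refl
  ... | true  | no _     | yes refl   = refl
  ... | true  | no j≢next | no j≢prev =
    [ (λ j≡next → ⊥-elim (j≢next j≡next)) , (λ j≡prev → ⊥-elim (j≢prev j≡prev)) ]′
      (cycAdj⇒next⊎prev i j (subst T (sym adj?) _))
  ... | false | yes refl | no _       = ⊥-elim (subst T adj? (cycAdj-next i))
  ... | false | no _     | yes refl   = ⊥-elim (subst T adj? (cycAdj-prev i))
  ... | false | no _     | no _       = refl

  ∑-cycAdj : ∀ i (h : Fin n → ℕ) → ∑[ j < n ] (⟦ cycAdj n i j ⟧ * h j) ≡ h (next i) + h (prev i)
  ∑-cycAdj i h = begin
    ∑[ j < n ] (⟦ cycAdj n i j ⟧ * h j)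
      ≡⟨ sum-cong-≗ {n} (λ j → trans (cong (_* h j) (⟦cycAdj⟧ i j)) (*-distribʳ-+ (h j) (δ j (next i)) (δ j (prev i)))) ⟩
    ∑[ j < n ] (δ j (next i) * h j + δ j (prev i) * h j)
      ≡⟨ ∑-distrib-+ {n} _ _ ⟩
    ∑[ j < n ] (δ j (next i) * h j) + ∑[ j < n ] (δ j (prev i) * h j)
      ≡⟨ cong₂ _+_ (∑-δ n (next i) h) (∑-δ n (prev i) h) ⟩
    h (next i) + h (prev i) ∎
    where open ≡-Reasoning

  adjC-next : ∀ j → T (adj C (ιC j (x j)) (ιC (next j) (x (next j))))
  adjC-next j = subst T (sym (trans (adjC-ι j _ (next j) _) (cAdjΣ-diff j _ (next j) _ (next≢ j))))
    (from T-∧ (from T-∧ (fromWitness {a? = x j ≟F x j} refl , fromWitness {a? = x (next j) ≟F x (next j)} refl) , cycAdj-next j))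

  open Walks C public
    using (Reach; ⟨_⟩; reach-refl; reach-suc; reach-cons; reach-uncons; reach-zero⇒≡; reach-sym; reach-++; dist-shortest)
  private
    module WG (i : Fin n) = Walks (G i)

  reach-ι : ∀ {m} i {a c} → WG.Reach i m a c → Reach m (ιC i a) (ιC i c)
  reach-ι {zero} i r with WG.reach-zero⇒≡ i r
  ... | refl = reach-refl _
  reach-ι {suc m} i r with WG.reach-uncons i r
  ... | inj₁ r′ = reach-suc (reach-ι i r′)
  ... | inj₂ (w , aw , r′) = reach-cons (subst T (sym (trans (adjC-ι i _ i w) (cAdjΣ-same i _ w))) aw) (reach-ι i r′)

  reach-around : ∀ m j k → toℕ k ≈ toℕ j + m → Reach m (ιC j (x j)) (ιC k (x k))
  reach-around zero j k k≈j+0 with toℕ-≈-injective {k} {j} (≈-trans k≈j+0 (≡⇒≈ (+-identityʳ _)))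
  ... | refl = reach-refl _
  reach-around (suc m) j k k≈j+1+m = reach-cons (adjC-next j) (reach-around m (next j) k k≈next+m)
    where
    k≈next+m : toℕ k ≈ toℕ (next j) + m
    k≈next+m = ≈-trans k≈j+1+m (≈-trans (≡⇒≈ (+-suc (toℕ j) m)) (≈-+ʳ m (≈-sym (toℕ-fromℕ%-≈ (suc (toℕ j))))))

  reach-cycDist : ∀ j k → Reach (cycDist j k) (ιC j (x j)) (ιC k (x k))
  reach-cycDist j k with cycDist-realised j k
  ... | inj₁ forwards  = reach-around (cycDist j k) j k forwards
  ... | inj₂ backwards = reach-sym (reach-around (cycDist j k) k j backwards)

  private
    reach-G : ∀ i (u v : Vtx (G i)) → ∃ λ m → WG.Reach i m u v
    reach-G i u v with connected i u v
    ... | m , t = m , WG.⟨ t ⟩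

    dist-G-step : ∀ i {a a′} v → T (adj (G i) a a′) → dist (G i) a v ≤ suc (dist (G i) a′ v)
    dist-G-step i {a′ = a′} v aa′ = WG.dist-cons i aa′ (proj₂ (reach-G i a′ v))

    shortest-G : ∀ i (u v : Vtx (G i)) → WG.Reach i (dist (G i) u v) u v
    shortest-G i u v = proj₁ (WG.dist-realised i (proj₂ (reach-G i u v)))

  circuitDist : (j : Fin n) → Vtx (G j) → (k : Fin n) → Vtx (G k) → ℕ
  circuitDist j b k c with j ≟F k
  ... | yes refl = dist (G j) b c
  ... | no _     = dist (G j) b (x j) + cycDist j k + dist (G k) (x k) c

  circuitDist-same : ∀ k b c → circuitDist k b k c ≡ dist (G k) b c
  circuitDist-same k b c with k ≟F k
  ... | yes refl = refl
  ... | no k≢k   = ⊥-elim (k≢k refl)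

  circuitDist-root : ∀ j k c → circuitDist j (x j) k c ≡ cycDist j k + dist (G k) (x k) c
  circuitDist-root j k c with j ≟F k
  ... | yes refl rewrite cycDist-refl j = refl
  ... | no _     rewrite WG.dist-refl j (x j) = refl

  circuitDist-step : ∀ j b j′ b′ k c → T (cAdjΣ n G x j b j′ b′) → circuitDist j b k c ≤ suc (circuitDist j′ b′ k c)
  circuitDist-step j b j′ b′ k c t with j ≟F j′
  circuitDist-step j b .j b′ k c t | yes refl with j ≟F k
  ... | yes refl = dist-G-step j c t
  ... | no _     = +-monoˡ-≤ (dist (G k) (x k) c) (+-monoˡ-≤ (cycDist j k) (dist-G-step j (x j) t))
  circuitDist-step j b j′ b′ k c t | no _ with to T-∧ t
  ... | roots , cyc-adj with to T-∧ roots
  ...   | b≡x , b′≡x with toWitness {a? = b ≟F x j} b≡x | toWitness {a? = b′ ≟F x j′} b′≡x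
  ...     | refl | refl rewrite circuitDist-root j k c | circuitDist-root j′ k c =
    +-monoˡ-≤ (dist (G k) (x k) c) (cycDist-cycAdj j j′ k cyc-adj)

  -- Along an edge of C the distance to (k, c) predicted by circuitDist drops by at most one, so it
  -- bounds the length of every walk to (k, c); and a walk of exactly that length exists.
  module _ (k : Fin n) (c : Vtx (G k)) where

    private
      toTarget : Vtx C → ℕ
      toTarget p = circuitDist (proj₁ (decode n G p)) (proj₂ (decode n G p)) k c

      toTarget-ι : ∀ j b → toTarget (ιC j b) ≡ circuitDist j b k c
      toTarget-ι j b rewrite decode-ι n G j b = refl

      walks-at-least : ∀ m p → Reach m p (ιC k c) → toTarget p ≤ m
      walks-at-least zero p r with reach-zero⇒≡ r
      ... | refl = ≤-reflexive (trans (toTarget-ι k c) (trans (circuitDist-same k c c) (WG.dist-refl k c)))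
      walks-at-least (suc m) p r with reach-uncons r
      ... | inj₁ r′ = m≤n⇒m≤1+n (walks-at-least m p r′)
      ... | inj₂ (w , pw , r′) =
        ≤-trans (circuitDist-step (proj₁ (decode n G p)) (proj₂ (decode n G p))
                                  (proj₁ (decode n G w)) (proj₂ (decode n G w)) k c pw)
                (s≤s (walks-at-least m w r′))

      walk-exists : ∀ j b → Reach (circuitDist j b k c) (ιC j b) (ιC k c)
      walk-exists j b with j ≟F k
      ... | yes refl = reach-ι j (shortest-G j b c)
      ... | no _     = reach-++ (dist (G j) b (x j) + cycDist j k)
                         (reach-++ (dist (G j) b (x j)) (reach-ι j (shortest-G j b (x j))) (reach-cycDist j k))
                         (reach-ι k (shortest-G k (x k) c))

    distC-ι : ∀ j b → dist C (ιC j b) (ιC k c) ≡ circuitDist j b k c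
    distC-ι j b = dist-shortest (walk-exists j b , λ m r → subst (_≤ m) (toTarget-ι j b) (walks-at-least m (ιC j b) r))

  distC-same : ∀ k b c → dist C (ιC k b) (ιC k c) ≡ dist (G k) b c
  distC-same k b c = trans (distC-ι k c k b) (circuitDist-same k b c)

  distC-root : ∀ j k c → dist C (ιC j (x j)) (ιC k c) ≡ cycDist j k + dist (G k) (x k) c
  distC-root j k c = trans (distC-ι k c j (x j)) (circuitDist-root j k c)

  -- Counting the edges of the circuit block by block

  sz : Fin n → ℕ
  sz i = size (G i)

  BlockFun : Set
  BlockFun = (i : Fin n) → Vtx (G i) → (j : Fin n) → Vtx (G j) → ℕ

  ∑Block : BlockFun → Fin n → Fin n → ℕ
  ∑Block F i j = ∑[ a < sz i ] ∑[ b < sz j ] F i a j b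

  ∑Blocks : BlockFun → ℕ
  ∑Blocks F = ∑[ i < n ] ∑[ j < n ] ∑Block F i j

  ∑∑C≡∑Blocks : ∀ (F : Vtx C → Vtx C → ℕ) → ∑∑ C F ≡ ∑Blocks (λ i a j b → F (ιC i a) (ιC j b))
  ∑∑C≡∑Blocks F = begin
    ∑[ p < size C ] ∑[ q < size C ] F p q
      ≡⟨ ∑-blocks n G _ ⟩
    ∑[ i < n ] ∑[ a < sz i ] ∑[ q < size C ] F (ιC i a) q
      ≡⟨ sum-cong-≗ {n} (λ i → sum-cong-≗ {sz i} (λ a → ∑-blocks n G _)) ⟩
    ∑[ i < n ] ∑[ a < sz i ] ∑[ j < n ] ∑[ b < sz j ] F (ιC i a) (ιC j b)
      ≡⟨ sum-cong-≗ {n} (λ i → ∑-comm {sz i} {n} _) ⟩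
    ∑Blocks (λ i a j b → F (ιC i a) (ιC j b)) ∎
    where open ≡-Reasoning

  ∑Blocks-cong : ∀ {F F′ : BlockFun} → (∀ i a j b → F i a j b ≡ F′ i a j b) → ∑Blocks F ≡ ∑Blocks F′
  ∑Blocks-cong F≡F′ = sum-cong-≗ {n} λ i → sum-cong-≗ {n} λ j →
    sum-cong-≗ {sz i} λ a → sum-cong-≗ {sz j} λ b → F≡F′ i a j b

  ∑Blocks-mono : ∀ {F F′ : BlockFun} → (∀ i a j b → F i a j b ≤ F′ i a j b) → ∑Blocks F ≤ ∑Blocks F′
  ∑Blocks-mono F≤F′ = ∑-mono-≤ n λ i → ∑-mono-≤ n λ j →
    ∑-mono-≤ (sz i) λ a → ∑-mono-≤ (sz j) λ b → F≤F′ i a j b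

  ∑Block-+ : ∀ (F F′ : BlockFun) i j → ∑Block (λ i a j b → F i a j b + F′ i a j b) i j ≡ ∑Block F i j + ∑Block F′ i j
  ∑Block-+ F F′ i j = trans (sum-cong-≗ {sz i} (λ a → ∑-distrib-+ {sz j} _ _)) (∑-distrib-+ {sz i} _ _)

  ∑Blocks-+ : ∀ (F F′ : BlockFun) → ∑Blocks (λ i a j b → F i a j b + F′ i a j b) ≡ ∑Blocks F + ∑Blocks F′
  ∑Blocks-+ F F′ = trans (sum-cong-≗ {n} (λ i → trans (sum-cong-≗ {n} (λ j → ∑Block-+ F F′ i j)) (∑-distrib-+ {n} _ _)))
                         (∑-distrib-+ {n} _ _)

  *-distribˡ-∑Block : ∀ c (F : BlockFun) i j → c * ∑Block F i j ≡ ∑Block (λ i a j b → c * F i a j b) i j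
  *-distribˡ-∑Block c F i j = trans (*-distribˡ-sum {sz i} c _) (sum-cong-≗ {sz i} (λ a → *-distribˡ-sum {sz j} c _))

  private
    ⟦∧∧⟧ : ∀ a b c g → ⟦ (a ∧ b) ∧ c ⟧ * g ≡ ⟦ a ⟧ * (⟦ b ⟧ * (⟦ c ⟧ * g))
    ⟦∧∧⟧ true  true  true  g = sym (trans (*-identityˡ _) (*-identityˡ _))
    ⟦∧∧⟧ true  true  false g = refl
    ⟦∧∧⟧ true  false c     g = refl
    ⟦∧∧⟧ false b     c     g = refl

  adjW : BlockFun
  adjW i a j b = ⟦ cAdjΣ n G x i a j b ⟧

  ∑Block-adjW-between : ∀ (g : BlockFun) i j → i ≢ j →
    ∑Block (λ i a j b → adjW i a j b * g i a j b) i j ≡ ⟦ cycAdj n i j ⟧ * g i (x i) j (x j)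
  ∑Block-adjW-between g i j i≢j = begin
    ∑Block (λ i a j b → adjW i a j b * g i a j b) i j
      ≡⟨ sum-cong-≗ {sz i} (λ a → sum-cong-≗ {sz j} (λ b → trans
           (cong (λ z → ⟦ z ⟧ * g i a j b) (cAdjΣ-diff i a j b i≢j))
           (⟦∧∧⟧ ⌊ a ≟F x i ⌋ ⌊ b ≟F x j ⌋ (cycAdj n i j) (g i a j b)))) ⟩
    ∑[ a < sz i ] ∑[ b < sz j ] (δ a (x i) * (δ b (x j) * (⟦ cycAdj n i j ⟧ * g i a j b)))
      ≡⟨ sum-cong-≗ {sz i} (λ a → sym (*-distribˡ-sum {sz j} (δ a (x i)) _)) ⟩
    ∑[ a < sz i ] (δ a (x i) * ∑[ b < sz j ] (δ b (x j) * (⟦ cycAdj n i j ⟧ * g i a j b)))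
      ≡⟨ ∑-δ (sz i) (x i) _ ⟩
    ∑[ b < sz j ] (δ b (x j) * (⟦ cycAdj n i j ⟧ * g i (x i) j b))
      ≡⟨ ∑-δ (sz j) (x j) _ ⟩
    ⟦ cycAdj n i j ⟧ * g i (x i) j (x j) ∎
    where open ≡-Reasoning

  -- in the circuit, block i is joined to other blocks only through its root x i
  ∑-adjC-from : ∀ (g : BlockFun) i →
    ∑[ j < n ] ∑Block (λ i a j b → adjW i a j b * g i a j b) i j
      ≡ ∑∑ (G i) (λ a b → ⟦ adj (G i) a b ⟧ * g i a i b) + (g i (x i) (next i) (x (next i)) + g i (x i) (prev i) (x (prev i)))
  ∑-adjC-from g i = begin
    ∑[ j < n ] ∑Block F i j
      ≡⟨ ∑-pick n i (∑Block F i) ⟩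
    ∑Block F i i + ∑[ j < n ] (⟦ not ⌊ j ≟F i ⌋ ⟧ * ∑Block F i j)
      ≡⟨ cong₂ _+_ inside (sum-cong-≗ {n} outside) ⟩
    ∑∑ (G i) (λ a b → ⟦ adj (G i) a b ⟧ * g i a i b) + ∑[ j < n ] (⟦ cycAdj n i j ⟧ * g i (x i) j (x j))
      ≡⟨ cong (_ +_) (∑-cycAdj i (λ j → g i (x i) j (x j))) ⟩
    ∑∑ (G i) (λ a b → ⟦ adj (G i) a b ⟧ * g i a i b) + (g i (x i) (next i) (x (next i)) + g i (x i) (prev i) (x (prev i))) ∎
    where
    open ≡-Reasoning
    F : BlockFun
    F i a j b = adjW i a j b * g i a j b
    inside : ∑Block F i i ≡ ∑∑ (G i) (λ a b → ⟦ adj (G i) a b ⟧ * g i a i b)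
    inside = sum-cong-≗ {sz i} λ a → sum-cong-≗ {sz i} λ b → cong (λ z → ⟦ z ⟧ * g i a i b) (cAdjΣ-same i a b)
    outside : ∀ j → ⟦ not ⌊ j ≟F i ⌋ ⟧ * ∑Block F i j ≡ ⟦ cycAdj n i j ⟧ * g i (x i) j (x j)
    outside j with j ≟F i
    ... | yes refl = sym (cong (_* g i (x i) i (x i)) (¬T⇒⟦⟧≡0 (cycAdj-irrefl i)))
    ... | no j≢i   = trans (+-identityʳ _) (∑Block-adjW-between g i j (j≢i ∘ sym))

  E : Fin n → ℕ
  E i = numEdges (G i)

  EC : ℕ
  EC = numEdges C

  open EdgeSums public using (twiceM; gap; 2*numEdges; 4*MoE)

  closerW : Vtx C → Vtx C → BlockFun
  closerW p q i a j b = adjW i a j b * closer C p q (ιC i a , ιC j b)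

  twiceMC≡∑Blocks : ∀ p q → twiceM C p q ≡ ∑Blocks (closerW p q)
  twiceMC≡∑Blocks p q = trans (∑∑C≡∑Blocks _)
    (∑Blocks-cong (λ i a j b → cong (λ z → ⟦ z ⟧ * closer C p q (ιC i a , ιC j b)) (adjC-ι i a j b)))

  2*EC≡∑Blocks : 2 * EC ≡ ∑Blocks adjW
  2*EC≡∑Blocks = trans (2*numEdges C) (trans (∑∑C≡∑Blocks _) (∑Blocks-cong (λ i a j b → cong ⟦_⟧ (adjC-ι i a j b))))

  ∑Block-adjW : ∀ i → ∑Block adjW i i ≡ 2 * E i
  ∑Block-adjW i = trans (sum-cong-≗ {sz i} λ a → sum-cong-≗ {sz i} λ b → cong ⟦_⟧ (cAdjΣ-same i a b))
                        (sym (2*numEdges (G i)))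

  2*EC≡∑[2E+2] : 2 * EC ≡ ∑[ i < n ] (2 * E i + 2)
  2*EC≡∑[2E+2] = trans 2*EC≡∑Blocks (sum-cong-≗ {n} λ i → begin
    ∑[ j < n ] ∑Block adjW i j
      ≡⟨ sum-cong-≗ {n} (λ j → sum-cong-≗ {sz i} λ a → sum-cong-≗ {sz j} λ b → sym (*-identityʳ _)) ⟩
    ∑[ j < n ] ∑Block (λ i a j b → adjW i a j b * 1) i j
      ≡⟨ ∑-adjC-from (λ _ _ _ _ → 1) i ⟩
    ∑∑ (G i) (λ a b → ⟦ adj (G i) a b ⟧ * 1) + 2
      ≡⟨ cong (_+ 2) (trans (sum-cong-≗ {sz i} λ a → sum-cong-≗ {sz i} λ b → *-identityʳ _) (sym (2*numEdges (G i)))) ⟩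
    2 * E i + 2 ∎)
    where open ≡-Reasoning

  outsideW : Fin n → Fin n → Fin n → ℕ
  outsideW i k l = ⟦ not (⌊ k ≟F i ⌋ ∧ ⌊ l ≟F i ⌋) ⟧

  ∑Outside : Fin n → BlockFun → ℕ
  ∑Outside i F = ∑Blocks (λ k c l d → outsideW i k l * F k c l d)

  ∑Blocks-split : ∀ i F → ∑Blocks F ≡ ∑Block F i i + ∑Outside i F
  ∑Blocks-split i F = begin
    ∑Blocks F
      ≡⟨ ∑Blocks-cong (λ k c l d → sym (trans (sym (*-distribʳ-+ (F k c l d) (δ k i * δ l i) (outsideW i k l)))
                                              (trans (cong (_* F k c l d) (partition k l)) (*-identityˡ _)))) ⟩
    ∑Blocks (λ k c l d → δ k i * δ l i * F k c l d + outsideW i k l * F k c l d)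
      ≡⟨ ∑Blocks-+ _ _ ⟩
    ∑Blocks (λ k c l d → δ k i * δ l i * F k c l d) + ∑Outside i F
      ≡⟨ cong (_+ ∑Outside i F) diagonal ⟩
    ∑Block F i i + ∑Outside i F ∎
    where
    open ≡-Reasoning
    partition : ∀ k l → δ k i * δ l i + outsideW i k l ≡ 1
    partition k l with k ≟F i | l ≟F i
    ... | yes _ | yes _ = refl
    ... | yes _ | no _  = refl
    ... | no _  | _     = refl
    diagonal : ∑Blocks (λ k c l d → δ k i * δ l i * F k c l d) ≡ ∑Block F i i
    diagonal = begin
      ∑Blocks (λ k c l d → δ k i * δ l i * F k c l d)
        ≡⟨ sum-cong-≗ {n} (λ k → sum-cong-≗ {n} (λ l →
             trans (sym (*-distribˡ-∑Block (δ k i * δ l i) F k l)) (*-assoc (δ k i) (δ l i) _))) ⟩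
      ∑[ k < n ] ∑[ l < n ] (δ k i * (δ l i * ∑Block F k l))
        ≡⟨ sum-cong-≗ {n} (λ k → sym (*-distribˡ-sum {n} (δ k i) _)) ⟩
      ∑[ k < n ] (δ k i * ∑[ l < n ] (δ l i * ∑Block F k l))
        ≡⟨ ∑-δ n i _ ⟩
      ∑[ l < n ] (δ l i * ∑Block F i l)
        ≡⟨ ∑-δ n i _ ⟩
      ∑Block F i i ∎

  edgesOutside : Fin n → ℕ
  edgesOutside i = ∑Outside i adjW

  edgesOutside+2E≡2EC : ∀ i → edgesOutside i + 2 * E i ≡ 2 * EC
  edgesOutside+2E≡2EC i = begin
    edgesOutside i + 2 * E i            ≡⟨ +-comm (edgesOutside i) _ ⟩
    2 * E i + edgesOutside i            ≡⟨ cong (_+ edgesOutside i) (∑Block-adjW i) ⟨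
    ∑Block adjW i i + edgesOutside i    ≡⟨ ∑Blocks-split i adjW ⟨
    ∑Blocks adjW                        ≡⟨ 2*EC≡∑Blocks ⟨
    2 * EC                              ∎
    where open ≡-Reasoning

  closerC-ι : ∀ i a b c d → closer C (ιC i a) (ιC i b) (ιC i c , ιC i d) ≡ closer (G i) a b (c , d)
  closerC-ι i a b c d = cong₂ (λ u v → ⟦ u <ᵇ v ⟧) (distE-ι a) (distE-ι b)
    where
    distE-ι : ∀ u → distE C (ιC i u) (ιC i c , ιC i d) ≡ distE (G i) u (c , d)
    distE-ι u = cong₂ _⊓_ (distC-same i u c) (distC-same i u d)

  ∑Block-closerW-ι : ∀ i a b → ∑Block (closerW (ιC i a) (ιC i b)) i i ≡ twiceM (G i) a b
  ∑Block-closerW-ι i a b = sum-cong-≗ {sz i} λ c → sum-cong-≗ {sz i} λ d →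
    cong₂ (λ u v → ⟦ u ⟧ * v) (cAdjΣ-same i c d) (closerC-ι i a b c d)

  ∑Outside-closerW : ∀ i p q → ∑Outside i (closerW p q) + ∑Outside i (closerW q p) ≤ edgesOutside i
  ∑Outside-closerW i p q = ≤-trans (≤-reflexive (sym (∑Blocks-+ _ _))) (∑Blocks-mono λ k c l d →
    pointwise (outsideW i k l) (adjW k c l d) (⟦<ᵇ⟧+⟦>ᵇ⟧≤1 (distE C p (ιC k c , ιC l d)) (distE C q (ιC k c , ιC l d))))
    where
    pointwise : ∀ {u v} a b → u + v ≤ 1 → a * (b * u) + a * (b * v) ≤ a * b
    pointwise {u} {v} a b u+v≤1 = begin
      a * (b * u) + a * (b * v) ≡⟨ sym (*-distribˡ-+ a (b * u) (b * v)) ⟩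
      a * (b * u + b * v)       ≡⟨ cong (a *_) (sym (*-distribˡ-+ b u v)) ⟩
      a * (b * (u + v))         ≤⟨ *-monoʳ-≤ a (*-monoʳ-≤ b u+v≤1) ⟩
      a * (b * 1)               ≡⟨ cong (a *_) (*-identityʳ b) ⟩
      a * b                     ∎
      where open ≤-Reasoning

  -- inside block i the circuit only adds edges outside G i, each counted by at most one side
  gapC-ι≤ : ∀ i a b → gap C (ιC i a) (ιC i b) ≤ gap (G i) a b + edgesOutside i
  gapC-ι≤ i a b = begin
    ∣ twiceM C p q - twiceM C q p ∣
      ≡⟨ cong₂ ∣_-_∣ (trans (twiceMC≡∑Blocks p q) (∑Blocks-split i (closerW p q)))
                     (trans (twiceMC≡∑Blocks q p) (∑Blocks-split i (closerW q p))) ⟩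
    ∣ ∑Block (closerW p q) i i + ∑Outside i (closerW p q) - (∑Block (closerW q p) i i + ∑Outside i (closerW q p)) ∣
      ≤⟨ ∣a+b-c+d∣≤∣a-c∣+∣b-d∣ (∑Block (closerW p q) i i) (∑Outside i (closerW p q))
                               (∑Block (closerW q p) i i) (∑Outside i (closerW q p)) ⟩
    ∣ ∑Block (closerW p q) i i - ∑Block (closerW q p) i i ∣ + ∣ ∑Outside i (closerW p q) - ∑Outside i (closerW q p) ∣
      ≤⟨ +-mono-≤ (≤-reflexive (cong₂ ∣_-_∣ (∑Block-closerW-ι i a b) (∑Block-closerW-ι i b a)))
                  (≤-trans (∣m-n∣≤m+n (∑Outside i (closerW p q)) (∑Outside i (closerW q p))) (∑Outside-closerW i p q)) ⟩
    gap (G i) a b + edgesOutside i ∎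
    where
    open ≤-Reasoning
    p = ιC i a
    q = ιC i b

  blockTerm : Fin n → ℕ
  blockTerm i = ∑∑ (G i) (λ a b → ⟦ adj (G i) a b ⟧ * gap C (ιC i a) (ιC i b))

  blockTerm≤ : ∀ i → blockTerm i ≤ 4 * MoE (G i) + edgesOutside i * (2 * E i)
  blockTerm≤ i = begin
    blockTerm i
      ≤⟨ ∑-mono-≤ (sz i) (λ a → ∑-mono-≤ (sz i) (λ b → *-monoʳ-≤ ⟦ adj (G i) a b ⟧ (gapC-ι≤ i a b))) ⟩
    ∑∑ (G i) (λ a b → ⟦ adj (G i) a b ⟧ * (gap (G i) a b + edgesOutside i))
      ≡⟨ sum-cong-≗ {sz i} (λ a → trans (sum-cong-≗ {sz i} (λ b → *-distribˡ-+ ⟦ adj (G i) a b ⟧ _ _)) (∑-distrib-+ {sz i} _ _)) ⟩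
    ∑[ a < sz i ] (∑[ b < sz i ] (⟦ adj (G i) a b ⟧ * gap (G i) a b) + ∑[ b < sz i ] (⟦ adj (G i) a b ⟧ * edgesOutside i))
      ≡⟨ ∑-distrib-+ {sz i} _ _ ⟩
    ∑∑ (G i) (λ a b → ⟦ adj (G i) a b ⟧ * gap (G i) a b) + ∑∑ (G i) (λ a b → ⟦ adj (G i) a b ⟧ * edgesOutside i)
      ≡⟨ cong₂ _+_ (sym (4*MoE (G i))) edges-weighted ⟩
    4 * MoE (G i) + edgesOutside i * (2 * E i) ∎
    where
    open ≤-Reasoning
    edges-weighted : ∑∑ (G i) (λ a b → ⟦ adj (G i) a b ⟧ * edgesOutside i) ≡ edgesOutside i * (2 * E i)
    edges-weighted = begin-equality
      ∑∑ (G i) (λ a b → ⟦ adj (G i) a b ⟧ * edgesOutside i)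
        ≡⟨ sum-cong-≗ {sz i} (λ a → trans (sum-cong-≗ {sz i} (λ b → *-comm _ (edgesOutside i)))
                                          (sym (*-distribˡ-sum {sz i} (edgesOutside i) _))) ⟩
      ∑[ a < sz i ] (edgesOutside i * ∑[ b < sz i ] ⟦ adj (G i) a b ⟧)
        ≡⟨ *-distribˡ-sum {sz i} (edgesOutside i) _ ⟨
      edgesOutside i * ∑∑ (G i) (λ a b → ⟦ adj (G i) a b ⟧)
        ≡⟨ cong (edgesOutside i *_) (2*numEdges (G i)) ⟨
      edgesOutside i * (2 * E i) ∎

  root : Fin n → Vtx C
  root i = ιC i (x i)

  rootGap : Fin n → Fin n → ℕ
  rootGap i j = gap C (root i) (root j)

  4*MoE-C : 4 * MoE C ≡ ∑[ i < n ] (blockTerm i + (rootGap i (next i) + rootGap i (prev i)))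
  4*MoE-C = begin
    4 * MoE C
      ≡⟨ 4*MoE C ⟩
    ∑∑ C (λ p q → ⟦ adj C p q ⟧ * gap C p q)
      ≡⟨ ∑∑C≡∑Blocks _ ⟩
    ∑Blocks (λ i a j b → ⟦ adj C (ιC i a) (ιC j b) ⟧ * gap C (ιC i a) (ιC j b))
      ≡⟨ ∑Blocks-cong (λ i a j b → cong (λ z → ⟦ z ⟧ * gap C (ιC i a) (ιC j b)) (adjC-ι i a j b)) ⟩
    ∑Blocks (λ i a j b → adjW i a j b * gap C (ιC i a) (ιC j b))
      ≡⟨ sum-cong-≗ {n} (∑-adjC-from (λ i a j b → gap C (ιC i a) (ιC j b))) ⟩
    ∑[ i < n ] (blockTerm i + (rootGap i (next i) + rootGap i (prev i))) ∎
    where open ≡-Reasoning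

  -- Cycle edges

  antipodalGaps : ℕ → ℕ
  antipodalGaps t = ∑ℕ t (λ j → ∣ atℕ n E j - atℕ n E (t + j) ∣)

  cycEdgeTerm : Fin n → Fin n → Fin n → Fin n → ℕ
  cycEdgeTerm i j k l = ⟦ cycDist i k ⊓ cycDist i l <ᵇ cycDist j k ⊓ cycDist j l ⟧

  rootTerm : Fin n → Fin n → Fin n → ℕ
  rootTerm i j k = ⟦ cycDist i k <ᵇ cycDist j k ⟧ * (2 * E k) + (cycEdgeTerm i j k (next k) + cycEdgeTerm i j k (prev k))

  distC-roots : ∀ i k → dist C (root i) (root k) ≡ cycDist i k
  distC-roots i k = trans (distC-root i k (x k)) (trans (cong (cycDist i k +_) (dist-refl (x k))) (+-identityʳ _))
    where open Walks (G k) using (dist-refl)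

  distE-root : ∀ i k c d → distE C (root i) (ιC k c , ιC k d) ≡ cycDist i k + (dist (G k) (x k) c ⊓ dist (G k) (x k) d)
  distE-root i k c d = trans (cong₂ _⊓_ (distC-root i k c) (distC-root i k d)) (sym (+-distribˡ-⊓ (cycDist i k) _ _))

  -- seen from the roots, a whole block is nearer to one root exactly when its own root is
  twiceMC-roots : ∀ i j → twiceM C (root i) (root j) ≡ ∑[ k < n ] rootTerm i j k
  twiceMC-roots i j = trans (twiceMC≡∑Blocks (root i) (root j)) (sum-cong-≗ {n} λ k →
    trans (∑-adjC-from (λ k c l d → closer C (root i) (root j) (ιC k c , ιC l d)) k) (cong₂ _+_ (inside k) (cycle k)))
    where
    inside : ∀ k → ∑∑ (G k) (λ c d → ⟦ adj (G k) c d ⟧ * closer C (root i) (root j) (ιC k c , ιC k d))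
                   ≡ ⟦ cycDist i k <ᵇ cycDist j k ⟧ * (2 * E k)
    inside k = begin
      ∑∑ (G k) (λ c d → ⟦ adj (G k) c d ⟧ * closer C (root i) (root j) (ιC k c , ιC k d))
        ≡⟨ sum-cong-≗ {sz k} (λ c → sum-cong-≗ {sz k} λ d → trans
             (cong (⟦ adj (G k) c d ⟧ *_) (trans (cong₂ (λ u v → ⟦ u <ᵇ v ⟧) (distE-root i k c d) (distE-root j k c d))
                                                  (⟦<ᵇ⟧-+ʳ (cycDist i k) (cycDist j k) _)))
             (*-comm ⟦ adj (G k) c d ⟧ K)) ⟩
      ∑[ c < sz k ] ∑[ d < sz k ] (K * ⟦ adj (G k) c d ⟧)
        ≡⟨ sum-cong-≗ {sz k} (λ c → *-distribˡ-sum {sz k} K _) ⟨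
      ∑[ c < sz k ] (K * ∑[ d < sz k ] ⟦ adj (G k) c d ⟧)
        ≡⟨ *-distribˡ-sum {sz k} K _ ⟨
      K * ∑∑ (G k) (λ c d → ⟦ adj (G k) c d ⟧)
        ≡⟨ cong (K *_) (2*numEdges (G k)) ⟨
      K * (2 * E k) ∎
      where
      open ≡-Reasoning
      K = ⟦ cycDist i k <ᵇ cycDist j k ⟧
    cycle : ∀ k → closer C (root i) (root j) (root k , root (next k)) + closer C (root i) (root j) (root k , root (prev k))
                  ≡ cycEdgeTerm i j k (next k) + cycEdgeTerm i j k (prev k)
    cycle k = cong₂ _+_ (edge (next k)) (edge (prev k))
      where
      edge : ∀ l → closer C (root i) (root j) (root k , root l) ≡ cycEdgeTerm i j k l
      edge l = cong₂ (λ u v → ⟦ u <ᵇ v ⟧) (cong₂ _⊓_ (distC-roots i k) (distC-roots i l))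
                                           (cong₂ _⊓_ (distC-roots j k) (distC-roots j l))

  -- Blocks are located by their offset from i₀ along Cₙ; the cycle edge from i₀ to next i₀
  -- joins the offsets 0 and 1.
  module AroundEdge (i₀ : Fin n) where

    open Shifted i₀ public

    E′ : ℕ → ℕ
    E′ d = E (shift d)

    nearerW : ℕ → ℕ → ℕ → ℕ
    nearerW s s′ d = ⟦ cycFrom s d <ᵇ cycFrom s′ d ⟧

    edgeW : ℕ → ℕ → ℕ → ℕ → ℕ
    edgeW s s′ d e = ⟦ cycFrom s d ⊓ cycFrom s e <ᵇ cycFrom s′ d ⊓ cycFrom s′ e ⟧

    forwardW backwardW : ℕ → ℕ → ℕ → ℕ
    forwardW  s s′ d = edgeW s s′ d (d + 1)
    backwardW s s′ d = edgeW s s′ d (d + (n ∸ 1))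

    term : ℕ → ℕ → ℕ → ℕ
    term s s′ d = nearerW s s′ d * (2 * E′ d) + (forwardW s s′ d + backwardW s s′ d)

    twiceMC-shifted : ∀ s s′ → twiceM C (root (shift s)) (root (shift s′)) ≡ ∑ℕ n (term s s′)
    twiceMC-shifted s s′ = trans (twiceMC-roots (shift s) (shift s′)) (trans (∑≡∑ℕ-shift _) (sum-cong-≗ {n} (λ d → same (toℕ d))))
      where
      same : ∀ d → rootTerm (shift s) (shift s′) (shift d) ≡ term s s′ d
      same d rewrite next-shift d | prev-shift d
                   | cycDist-shift s d | cycDist-shift s′ d | cycDist-shift s (d + 1) | cycDist-shift s′ (d + 1)
                   | cycDist-shift s (d + (n ∸ 1)) | cycDist-shift s′ (d + (n ∸ 1)) = refl

    rootGap-next : rootGap i₀ (next i₀) ≡ ∣ ∑ℕ n (term 0 1) - ∑ℕ n (term 1 0) ∣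
    rootGap-next = trans (cong₂ rootGap (sym shift-0) (sym shift-1)) (cong₂ ∣_-_∣ (twiceMC-shifted 0 1) (twiceMC-shifted 1 0))
      where
      shift-0 : shift 0 ≡ i₀
      shift-0 = toℕ-≈-injective (≈-trans (toℕ-fromℕ%-≈ (toℕ i₀ + 0)) (≡⇒≈ (+-identityʳ (toℕ i₀))))
      shift-1 : shift 1 ≡ next i₀
      shift-1 = fromℕ%-≈ (≡⇒≈ (+-comm (toℕ i₀) 1))

    2*EC≡∑ℕ : 2 * EC ≡ ∑ℕ n (λ d → 2 * E′ d + 2)
    2*EC≡∑ℕ = trans 2*EC≡∑[2E+2] (∑≡∑ℕ-shift (λ i → 2 * E i + 2))

    private
      regroup : ∀ x₁ n₁ p₁ x₂ n₂ p₂ e c c₀ c₁ →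
        x₁ * e + (n₁ + p₁) + (x₂ * e + (n₂ + p₂)) + (c * e + c₀ + c₁)
          ≡ (x₁ + x₂ + c) * e + ((n₁ + n₂ + c₀) + (p₁ + p₂ + c₁))
      regroup = solve-∀

    private
      d+1+n≈d+1 : ∀ d → d + n + 1 ≈ d + 1
      d+1+n≈d+1 d = ≈-trans (≡⇒≈ (trans (+-assoc d n 1) (trans (cong (d +_) (+-comm n 1)) (sym (+-assoc d 1 n))))) (+n≈ (d + 1))

      d+[n∸1]+1≈d : ∀ d → d + (n ∸ 1) + 1 ≈ d
      d+[n∸1]+1≈d d = ≈-trans (≡⇒≈ (trans (+-assoc d (n ∸ 1) 1) (cong (d +_) (trans (+-comm (n ∸ 1) 1) 1+[n∸1]≡n)))) (+n≈ d)

    forwardW-periodic : ∀ s s′ → Periodic n (forwardW s s′)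
    forwardW-periodic s s′ d = cong₂ (λ u v → ⟦ u <ᵇ v ⟧)
      (cong₂ _⊓_ (cycFrom-periodic s d) (cycFrom-≈ s (d+1+n≈d+1 d)))
      (cong₂ _⊓_ (cycFrom-periodic s′ d) (cycFrom-≈ s′ (d+1+n≈d+1 d)))

    backward≡forward : ∀ s s′ d → backwardW s s′ d ≡ forwardW s s′ (d + (n ∸ 1))
    backward≡forward s s′ d = cong₂ (λ u v → ⟦ u <ᵇ v ⟧) (swap s) (swap s′)
      where
      swap : ∀ s → cycFrom s d ⊓ cycFrom s (d + (n ∸ 1)) ≡ cycFrom s (d + (n ∸ 1)) ⊓ cycFrom s (d + (n ∸ 1) + 1)
      swap s = trans (⊓-comm _ _) (cong (cycFrom s (d + (n ∸ 1)) ⊓_) (sym (cycFrom-≈ s (d+[n∸1]+1≈d d))))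

    ∑backward≡∑forward : ∀ s s′ → ∑ℕ n (backwardW s s′) ≡ ∑ℕ n (forwardW s s′)
    ∑backward≡∑forward s s′ = trans (sum-cong-≗ {n} (λ d → backward≡forward s s′ (toℕ d)))
                                    (∑ℕ-rotate n (forwardW s s′) (n ∸ 1) (forwardW-periodic s s′))

    -- reflecting Cₙ across the edge c₀c₁ swaps its ends and maps the cycle edge at d to the one at n ∸ d
    forwardW-reflect : ∀ d → d ≤ n → forwardW 0 1 (n ∸ d) ≡ forwardW 1 0 d
    forwardW-reflect d d≤n = cong₂ (λ u v → ⟦ u <ᵇ v ⟧)
      (trans (cong₂ _⊓_ (mirror (n ∸ d) (d + 1) (sym (+-assoc w d 1)))
                        (mirror (n ∸ d + 1) d (shuffle w d)))
             (⊓-comm (cycFrom 1 (d + 1)) (cycFrom 1 d)))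
      (trans (cong₂ _⊓_ (sym (mirror (d + 1) (n ∸ d) (trans (+-comm (d + 1) w) (sym (+-assoc w d 1)))))
                        (sym (mirror d (n ∸ d + 1) (trans (+-comm d (w + 1)) (shuffle w d)))))
             (⊓-comm (cycFrom 0 (d + 1)) (cycFrom 0 d)))
      where
      w = n ∸ d
      mirror : ∀ a b → a + b ≡ w + d + 1 → cycFrom 0 a ≡ cycFrom 1 b
      mirror a b eq = cycFrom-reflect a b (trans eq (trans (cong (_+ 1) (m∸n+n≡m d≤n)) (+-comm n 1)))
      shuffle : ∀ w d → w + 1 + d ≡ w + d + 1
      shuffle = solve-∀

    cycleEdges-balanced : ∑ℕ n (λ d → forwardW 0 1 d + backwardW 0 1 d) ≡ ∑ℕ n (λ d → forwardW 1 0 d + backwardW 1 0 d)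
    cycleEdges-balanced = begin
      ∑ℕ n (λ d → forwardW 0 1 d + backwardW 0 1 d)
        ≡⟨ ∑-distrib-+ {n} _ _ ⟩
      ∑ℕ n (forwardW 0 1) + ∑ℕ n (backwardW 0 1)
        ≡⟨ cong₂ _+_ (sym ∑forward-swap) (trans (∑backward≡∑forward 0 1) (sym ∑forward-swap)) ⟩
      ∑ℕ n (forwardW 1 0) + ∑ℕ n (forwardW 1 0)
        ≡⟨ cong (∑ℕ n (forwardW 1 0) +_) (∑backward≡∑forward 1 0) ⟨
      ∑ℕ n (forwardW 1 0) + ∑ℕ n (backwardW 1 0)
        ≡⟨ ∑-distrib-+ {n} _ _ ⟨
      ∑ℕ n (λ d → forwardW 1 0 d + backwardW 1 0 d) ∎
      where
      open ≡-Reasoning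
      ∑forward-swap : ∑ℕ n (forwardW 1 0) ≡ ∑ℕ n (forwardW 0 1)
      ∑forward-swap = trans (sym (∑ℕ-cong< n (λ d d<n → forwardW-reflect d (<⇒≤ d<n))))
                            (∑ℕ-reverse n (forwardW 0 1) (forwardW-periodic 0 1 0))

    module OddCycle (t : ℕ) (n≡2t∸1 : n ≡ t + t ∸ 1) where

      private
        2≤t : 2 ≤ t
        2≤t = at-least-2 t (subst (3 ≤_) n≡2t∸1 n≥3)
          where
          at-least-2 : ∀ t → 3 ≤ t + t ∸ 1 → 2 ≤ t
          at-least-2 (suc (suc _)) _ = s≤s (s≤s z≤n)
          at-least-2 (suc zero) (s≤s ())

        t+t≡1+n : t + t ≡ suc n
        t+t≡1+n = trans (sym (m∸n+n≡m {t + t} {1} (≤-trans (s≤s z≤n) (≤-trans 2≤t (m≤m+n t t)))))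
                        (trans (+-comm (t + t ∸ 1) 1) (cong suc (sym n≡2t∸1)))

        t<n : t < n
        t<n = subst (t <_) (sym n≡2t∸1) (below t 2≤t)
          where
          below : ∀ t → 2 ≤ t → t < t + t ∸ 1
          below (suc (suc u)) _ = s≤s (m≤n+m (suc (suc u)) u)
          below (suc zero) (s≤s ())

        cycFrom-0-n : cycFrom 0 (1 + (n ∸ 1)) ≡ 0
        cycFrom-0-n = trans (cycFrom-≈ 0 (≈-trans (≡⇒≈ 1+[n∸1]≡n) n≈0)) (cycFrom-self 0)

      -- the antipodal block and the edge c₀c₁ itself, met from both ends, are equidistant from c₀ and c₁
      odd-pointwise : ∀ d → term 0 1 d + term 1 0 d + (δℕ d t * (2 * E′ d) + δℕ d 0 + δℕ d 1) ≤ 2 * E′ d + 2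
      odd-pointwise d = begin
        term 0 1 d + term 1 0 d + (δℕ d t * (2 * E′ d) + δℕ d 0 + δℕ d 1)
          ≡⟨ regroup (nearerW 0 1 d) (forwardW 0 1 d) (backwardW 0 1 d) (nearerW 1 0 d) (forwardW 1 0 d) (backwardW 1 0 d)
                     (2 * E′ d) (δℕ d t) (δℕ d 0) (δℕ d 1) ⟩
        (nearerW 0 1 d + nearerW 1 0 d + δℕ d t) * (2 * E′ d)
          + ((forwardW 0 1 d + forwardW 1 0 d + δℕ d 0) + (backwardW 0 1 d + backwardW 1 0 d + δℕ d 1))
          ≤⟨ +-mono-≤ (*-monoˡ-≤ (2 * E′ d) (⟦<ᵇ⟧+⟦>ᵇ⟧+tie≤1 _ _ (δℕ d t) (δℕ≤1 d t) antipode))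
                      (+-mono-≤ (⟦<ᵇ⟧+⟦>ᵇ⟧+tie≤1 _ _ (δℕ d 0) (δℕ≤1 d 0) edge-at-0)
                                (⟦<ᵇ⟧+⟦>ᵇ⟧+tie≤1 _ _ (δℕ d 1) (δℕ≤1 d 1) edge-at-1)) ⟩
        1 * (2 * E′ d) + (1 + 1)
          ≡⟨ cong (_+ 2) (*-identityˡ _) ⟩
        2 * E′ d + 2 ∎
        where
        open ≤-Reasoning
        antipode : δℕ d t ≡ 1 → cycFrom 0 d ≡ cycFrom 1 d
        antipode δ≡1 rewrite δℕ≡1⇒≡ d t δ≡1 = cycFrom-reflect t t t+t≡1+n
        edge-at-0 : δℕ d 0 ≡ 1 → cycFrom 0 d ⊓ cycFrom 0 (d + 1) ≡ cycFrom 1 d ⊓ cycFrom 1 (d + 1)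
        edge-at-0 δ≡1 rewrite δℕ≡1⇒≡ d 0 δ≡1 | cycFrom-self 0 | cycFrom-self 1 = sym (⊓-zeroʳ (cycFrom 1 0))
        edge-at-1 : δℕ d 1 ≡ 1 → cycFrom 0 d ⊓ cycFrom 0 (d + (n ∸ 1)) ≡ cycFrom 1 d ⊓ cycFrom 1 (d + (n ∸ 1))
        edge-at-1 δ≡1 rewrite δℕ≡1⇒≡ d 1 δ≡1 | cycFrom-self 1 | cycFrom-0-n = ⊓-zeroʳ (cycFrom 0 1)

      rootGap-next≤ : rootGap i₀ (next i₀) + (2 * E′ t + 2) ≤ 2 * EC
      rootGap-next≤ = begin
        rootGap i₀ (next i₀) + (2 * E′ t + 2)
          ≡⟨ cong₂ _+_ rootGap-next (sym ∑ℕ-ties) ⟩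
        ∣ ∑ℕ n (term 0 1) - ∑ℕ n (term 1 0) ∣ + ∑ℕ n ties
          ≤⟨ +-monoˡ-≤ (∑ℕ n ties) (∣m-n∣≤m+n (∑ℕ n (term 0 1)) (∑ℕ n (term 1 0))) ⟩
        ∑ℕ n (term 0 1) + ∑ℕ n (term 1 0) + ∑ℕ n ties
          ≡⟨ cong (_+ ∑ℕ n ties) (∑-distrib-+ {n} _ _) ⟨
        ∑ℕ n (λ d → term 0 1 d + term 1 0 d) + ∑ℕ n ties
          ≡⟨ ∑-distrib-+ {n} _ _ ⟨
        ∑ℕ n (λ d → term 0 1 d + term 1 0 d + ties d)
          ≤⟨ ∑-mono-≤ n (λ d → odd-pointwise (toℕ d)) ⟩
        ∑ℕ n (λ d → 2 * E′ d + 2)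
          ≡⟨ 2*EC≡∑ℕ ⟨
        2 * EC ∎
        where
        open ≤-Reasoning
        ties : ℕ → ℕ
        ties d = δℕ d t * (2 * E′ d) + δℕ d 0 + δℕ d 1
        ∑ℕ-δℕ : ∀ c → c < n → ∑ℕ n (λ d → δℕ d c) ≡ 1
        ∑ℕ-δℕ c c<n = trans (sum-cong-≗ {n} (λ d → sym (*-identityʳ (δℕ (toℕ d) c)))) (∑ℕ-δ n c (λ _ → 1) c<n)
        ∑ℕ-ties : ∑ℕ n ties ≡ 2 * E′ t + 2
        ∑ℕ-ties = begin-equality
          ∑ℕ n ties
            ≡⟨ ∑-distrib-+ {n} _ _ ⟩
          ∑ℕ n (λ d → δℕ d t * (2 * E′ d) + δℕ d 0) + ∑ℕ n (λ d → δℕ d 1)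
            ≡⟨ cong (_+ ∑ℕ n (λ d → δℕ d 1)) (∑-distrib-+ {n} _ _) ⟩
          ∑ℕ n (λ d → δℕ d t * (2 * E′ d)) + ∑ℕ n (λ d → δℕ d 0) + ∑ℕ n (λ d → δℕ d 1)
            ≡⟨ cong₂ _+_ (cong₂ _+_ (∑ℕ-δ n t (λ d → 2 * E′ d) t<n) (∑ℕ-δℕ 0 0<n)) (∑ℕ-δℕ 1 1<n) ⟩
          2 * E′ t + 1 + 1
            ≡⟨ +-assoc (2 * E′ t) 1 1 ⟩
          2 * E′ t + 2 ∎

    module EvenSplit (t : ℕ) (n≡t+t : n ≡ t + t) where

      open EvenCycle t n≡t+t

      private
        weighted : ℕ → ℕ → ℕ
        weighted s s′ = ∑ℕ n (λ d → nearerW s s′ d * E′ d)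

        ∑term : ∀ s s′ → ∑ℕ n (term s s′) ≡ 2 * weighted s s′ + ∑ℕ n (λ d → forwardW s s′ d + backwardW s s′ d)
        ∑term s s′ = trans (∑-distrib-+ {n} _ _) (cong (_+ ∑ℕ n (λ d → forwardW s s′ d + backwardW s s′ d)) (trans
          (sum-cong-≗ {n} (λ d → x*[2*y]≡2*[x*y] (nearerW s s′ (toℕ d)) (E′ (toℕ d))))
          (sym (*-distribˡ-sum {n} 2 _))))
          where
          x*[2*y]≡2*[x*y] : ∀ a b → a * (2 * b) ≡ 2 * (a * b)
          x*[2*y]≡2*[x*y] = solve-∀

        weighted-pairs : ∀ s s′ → weighted s s′ ≡ ∑ℕ t (λ j → nearerW s s′ j * E′ j + nearerW s s′ (t + j) * E′ (t + j))
        weighted-pairs s s′ = trans (cong (λ m → ∑ℕ m (λ d → nearerW s s′ d * E′ d)) n≡t+t)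
                                    (trans (∑ℕ-+ t t (λ d → nearerW s s′ d * E′ d)) (sym (∑-distrib-+ {t} _ _)))

        shifted-gaps : ∑ℕ t (λ j → ∣ E′ j - E′ (t + j) ∣) ≡ antipodalGaps t
        shifted-gaps = begin
          ∑ℕ t (λ j → ∣ E′ j - E′ (t + j) ∣)
            ≡⟨ sum-cong-≗ {t} (λ j → cong₂ (λ u v → ∣ E (fromℕ% u) - E (fromℕ% v) ∣)
                                           (+-comm (toℕ i₀) (toℕ j)) (shuffle (toℕ i₀) t (toℕ j))) ⟩
          ∑ℕ t (λ j → sizeGap (j + toℕ i₀))
            ≡⟨ ∑ℕ-rotate t sizeGap (toℕ i₀) sizeGap-periodic ⟩
          ∑ℕ t sizeGap
            ≡⟨ ∑ℕ-cong< t (λ j j<t → cong₂ ∣_-_∣ (sym (atℕ-fromℕ% E j (<-trans j<t t<n)))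
                 (trans (cong (E ∘′ fromℕ%) (+-comm j t))
                        (sym (atℕ-fromℕ% E (t + j) (subst (t + j <_) (sym n≡t+t) (+-monoʳ-< t j<t)))))) ⟩
          antipodalGaps t ∎
          where
          open ≡-Reasoning
          shuffle : ∀ i t j → i + (t + j) ≡ j + i + t
          shuffle = solve-∀
          sizeGap : ℕ → ℕ
          sizeGap y = ∣ E (fromℕ% y) - E (fromℕ% (y + t)) ∣
          sizeGap-periodic : Periodic t sizeGap
          sizeGap-periodic y = trans (cong (λ z → ∣ E (fromℕ% (y + t)) - E z ∣)
                                   (fromℕ%-≈ (≈-trans (≡⇒≈ (trans (+-assoc y t t) (cong (y +_) (sym n≡t+t)))) (+n≈ y))))
                                 (∣-∣-comm (E (fromℕ% (y + t))) (E (fromℕ% y)))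

      rootGap-next≤ : rootGap i₀ (next i₀) ≤ 2 * antipodalGaps t
      rootGap-next≤ = begin
        rootGap i₀ (next i₀)
          ≡⟨ rootGap-next ⟩
        ∣ ∑ℕ n (term 0 1) - ∑ℕ n (term 1 0) ∣
          ≡⟨ cong₂ ∣_-_∣ (∑term 0 1) (trans (∑term 1 0) (cong (2 * weighted 1 0 +_) (sym cycleEdges-balanced))) ⟩
        ∣ 2 * weighted 0 1 + Y - (2 * weighted 1 0 + Y) ∣
          ≡⟨ cong₂ ∣_-_∣ (+-comm (2 * weighted 0 1) Y) (+-comm (2 * weighted 1 0) Y) ⟩
        ∣ Y + 2 * weighted 0 1 - (Y + 2 * weighted 1 0) ∣
          ≡⟨ ∣m+n-m+o∣≡∣n-o∣ Y _ _ ⟩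
        ∣ 2 * weighted 0 1 - 2 * weighted 1 0 ∣
          ≡⟨ *-distribˡ-∣-∣ 2 (weighted 0 1) (weighted 1 0) ⟨
        2 * ∣ weighted 0 1 - weighted 1 0 ∣
          ≡⟨ cong (λ z → 2 * z) (cong₂ ∣_-_∣ (weighted-pairs 0 1) (weighted-pairs 1 0)) ⟩
        2 * ∣ ∑ℕ t (pair 0 1) - ∑ℕ t (pair 1 0) ∣
          ≤⟨ *-monoʳ-≤ 2 (∣∑-∑∣≤∑∣-∣ t _ _) ⟩
        2 * ∑ℕ t (λ j → ∣ pair 0 1 j - pair 1 0 j ∣)
          ≡⟨ cong (2 *_) (trans (∑ℕ-cong< t (λ j j<t → ∣⟦<ᵇ⟧-split∣ (E′ j) (E′ (t + j)) (opposite-sides j j<t))) shifted-gaps) ⟩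
        2 * antipodalGaps t ∎
        where
        open ≤-Reasoning
        Y = ∑ℕ n (λ d → forwardW 0 1 d + backwardW 0 1 d)
        pair : ℕ → ℕ → ℕ → ℕ
        pair s s′ j = nearerW s s′ j * E′ j + nearerW s s′ (t + j) * E′ (t + j)

  base : ℕ
  base = sumFin n (λ i → MoE (G i)) + sumFin n (λ i → E i * (EC ∸ E i))

  edgesOutside≡2*[EC∸E] : ∀ i → edgesOutside i ≡ 2 * (EC ∸ E i)
  edgesOutside≡2*[EC∸E] i = begin
    edgesOutside i                   ≡⟨ m+n∸n≡m (edgesOutside i) (2 * E i) ⟨
    edgesOutside i + 2 * E i ∸ 2 * E i ≡⟨ cong (_∸ 2 * E i) (edgesOutside+2E≡2EC i) ⟩
    2 * EC ∸ 2 * E i                 ≡⟨ *-distribˡ-∸ 2 EC (E i) ⟨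
    2 * (EC ∸ E i)                   ∎
    where open ≡-Reasoning

  ∑blockTerm≤ : ∑[ i < n ] blockTerm i ≤ 4 * base
  ∑blockTerm≤ = begin
    ∑[ i < n ] blockTerm i
      ≤⟨ ∑-mono-≤ n blockTerm≤ ⟩
    ∑[ i < n ] (4 * MoE (G i) + edgesOutside i * (2 * E i))
      ≡⟨ sum-cong-≗ {n} (λ i → cong (λ z → 4 * MoE (G i) + z * (2 * E i)) (edgesOutside≡2*[EC∸E] i)) ⟩
    ∑[ i < n ] (4 * MoE (G i) + 2 * (EC ∸ E i) * (2 * E i))
      ≡⟨ sum-cong-≗ {n} (λ i → regroup (MoE (G i)) (EC ∸ E i) (E i)) ⟩
    ∑[ i < n ] (4 * (MoE (G i) + E i * (EC ∸ E i)))
      ≡⟨ *-distribˡ-sum {n} 4 _ ⟨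
    4 * ∑[ i < n ] (MoE (G i) + E i * (EC ∸ E i))
      ≡⟨ cong (4 *_) (∑-distrib-+ {n} _ _) ⟩
    4 * (∑[ i < n ] MoE (G i) + ∑[ i < n ] (E i * (EC ∸ E i)))
      ≡⟨ cong (4 *_) (cong₂ _+_ (sumFin≡∑ n _) (sumFin≡∑ n _)) ⟨
    4 * base ∎
    where
    open ≤-Reasoning
    regroup : ∀ m c e → 4 * m + 2 * c * (2 * e) ≡ 4 * (m + e * c)
    regroup = solve-∀

  ∑rootGaps : ℕ
  ∑rootGaps = ∑[ i < n ] rootGap i (next i)

  4*MoE-C≤ : 4 * MoE C ≤ 4 * base + (∑rootGaps + ∑rootGaps)
  4*MoE-C≤ = begin
    4 * MoE C
      ≡⟨ 4*MoE-C ⟩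
    ∑[ i < n ] (blockTerm i + (rootGap i (next i) + rootGap i (prev i)))
      ≡⟨ ∑-distrib-+ {n} _ _ ⟩
    ∑[ i < n ] blockTerm i + ∑[ i < n ] (rootGap i (next i) + rootGap i (prev i))
      ≤⟨ +-mono-≤ ∑blockTerm≤ (≤-reflexive (trans (∑-distrib-+ {n} _ _) (cong (∑rootGaps +_) backwards))) ⟩
    4 * base + (∑rootGaps + ∑rootGaps) ∎
    where
    open ≤-Reasoning
    backwards : ∑[ i < n ] rootGap i (prev i) ≡ ∑rootGaps
    backwards = trans (sum-cong-≗ {n} (λ i → trans (∣-∣-comm (twiceM C (root i) (root (prev i))) _)
                                                   (cong (rootGap (prev i)) (sym (next-prev i)))))
                      (∑-rotate (λ i → rootGap i (next i)) (n ∸ 1))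

  even-bound : ∀ t → n ≡ t + t → MoE C ≤ base + n * sumℕ t (λ i → ∣ atℕ n E i - atℕ n E (t + i) ∣)
  even-bound t n≡t+t = *-cancelˡ-≤ 4 (begin
    4 * MoE C                                  ≤⟨ 4*MoE-C≤ ⟩
    4 * base + (∑rootGaps + ∑rootGaps)         ≤⟨ +-monoʳ-≤ (4 * base) (+-mono-≤ ∑rootGaps≤ ∑rootGaps≤) ⟩
    4 * base + (n * (2 * S) + n * (2 * S))     ≡⟨ regroup base n S ⟩
    4 * (base + n * S)                         ≡⟨ cong (λ z → 4 * (base + n * z)) (sumℕ≡∑ℕ t _) ⟨
    4 * (base + n * sumℕ t (λ i → ∣ atℕ n E i - atℕ n E (t + i) ∣)) ∎)
    where
    open ≤-Reasoning
    S = antipodalGaps t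
    ∑rootGaps≤ : ∑rootGaps ≤ n * (2 * S)
    ∑rootGaps≤ = ≤-trans (∑-mono-≤ n (λ i → AroundEdge.EvenSplit.rootGap-next≤ i t n≡t+t))
                         (≤-reflexive (∑-const n (2 * S)))
    regroup : ∀ b n s → 4 * b + (n * (2 * s) + n * (2 * s)) ≡ 4 * (b + n * s)
    regroup = solve-∀

  odd-bound : ∀ t → n ≡ t + t ∸ 1 → MoE C ≤ base + (n ∸ 1) * EC
  odd-bound t n≡2t∸1 = *-cancelˡ-≤ 4 (begin
    4 * MoE C                                          ≤⟨ 4*MoE-C≤ ⟩
    4 * base + (∑rootGaps + ∑rootGaps)                 ≤⟨ +-monoʳ-≤ (4 * base) (+-mono-≤ ∑rootGaps≤ ∑rootGaps≤) ⟩
    4 * base + ((n ∸ 1) * (2 * EC) + (n ∸ 1) * (2 * EC)) ≡⟨ regroup base (n ∸ 1) EC ⟩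
    4 * (base + (n ∸ 1) * EC)                          ∎)
    where
    open ≤-Reasoning
    antipode : Fin n → ℕ
    antipode i = 2 * E (fromℕ% (toℕ i + t)) + 2
    with-antipodes : ∑rootGaps + 2 * EC ≤ n * (2 * EC)
    with-antipodes = begin
      ∑rootGaps + 2 * EC
        ≡⟨ cong (∑rootGaps +_) (trans 2*EC≡∑[2E+2] (sym (∑-rotate (λ i → 2 * E i + 2) t))) ⟩
      ∑rootGaps + ∑[ i < n ] antipode i
        ≡⟨ ∑-distrib-+ {n} _ _ ⟨
      ∑[ i < n ] (rootGap i (next i) + antipode i)
        ≤⟨ ∑-mono-≤ n (λ i → AroundEdge.OddCycle.rootGap-next≤ i t n≡2t∸1) ⟩
      ∑[ i < n ] (2 * EC)
        ≡⟨ ∑-const n (2 * EC) ⟩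
      n * (2 * EC) ∎
    ∑rootGaps≤ : ∑rootGaps ≤ (n ∸ 1) * (2 * EC)
    ∑rootGaps≤ = begin
      ∑rootGaps                            ≡⟨ m+n∸n≡m ∑rootGaps (2 * EC) ⟨
      ∑rootGaps + 2 * EC ∸ 2 * EC          ≤⟨ ∸-monoˡ-≤ (2 * EC) with-antipodes ⟩
      n * (2 * EC) ∸ 2 * EC                ≡⟨ cong (n * (2 * EC) ∸_) (*-identityˡ (2 * EC)) ⟨
      n * (2 * EC) ∸ 1 * (2 * EC)          ≡⟨ *-distribʳ-∸ (2 * EC) n 1 ⟨
      (n ∸ 1) * (2 * EC)                   ∎
    regroup : ∀ b m c → 4 * b + (m * (2 * c) + m * (2 * c)) ≡ 4 * (b + m * c)
    regroup = solve-∀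

mainTheorem7 : (n : ℕ) → 3 ≤ n → (G : Fin n → Graph) → (x : (i : Fin n) → Vtx (G i)) →
    (∀ i → Connected (G i)) →
    let C = circuit n G x
        E = λ (i : Fin n) → numEdges (G i)
        base = sumFin n (λ i → MoE (G i)) + sumFin n (λ i → E i * (numEdges C ∸ E i))
    in (∀ t → n ≡ t + t → MoE C ≤ base + n * sumℕ t (λ i → ∣ atℕ n E i - atℕ n E (t + i) ∣))
       × (∀ t → n ≡ t + t ∸ 1 → MoE C ≤ base + (n ∸ 1) * numEdges C)
mainTheorem7 n n≥3 G x connected = even-bound , odd-bound
  where open Circuit n n≥3 G x connected
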